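{- Let $D=(N,A,s,t)$ be a network and $a\in A$. The inequality $x(a)\ge0$ defines a facet of the flow polytope $\mathcal F(D)$ if and only if $a\in\widetilde A$ and moreover either $D$ has a single $s$--$t$ path, or the arc $a$ is good.
   Context: A network $D=(N,A,s,t)$ consists of a finite set $N$ of nodes, a set $A$ of arcs (ordered pairs of distinct nodes) such that $(N,A)$ is an acyclic directed graph, and designated nodes $s$ (source) and $t$ (sink). Paths are sequences of arcs $(u_1,u_2),\dots,(u_{m-1},u_m)$ with pairwise distinct nodes; an $s$--$t$ path starts at $s$ and ends at $t$. For $x\in\mathbb R^A$ and $B\subseteq A$, $x(B)=\sum_{a\in B}x(a)$; $\delta^\pm(v)$ are the arcs with tail ($+$), resp. head ($-$), $v$. The flow polytope $\mathcal F(D)\subseteq\mathbb R^A$ is the set of $x$ with $x\ge0$, $x(\delta^+(v))-x(\delta^-(v))=0$ for $v\ne s,t$, and $x(\delta^+(s))-x(\delta^-(s))=1$. $\widetilde A$ is the set of arcs lying on at least one $s$--$t$ path; for a node $u$, $\widetilde d^-(u)$ and $\widetilde d^+(u)$ are the numbers of arcs of $\widetilde A$ with head, resp. tail, $u$. A corridor is a path $(u_1,u_2),\dots,(u_{m-1},u_m)$ with arcs in $\widetilde A$ such that $\widetilde d^-(u_i)=\widetilde d^+(u_i)=1$ for $2\le i\le m-1$ and ($\widetilde d^-(u_1)\ne1$ or $\widetilde d^+(u_1)\ne1$) and ($\widetilde d^-(u_m)\ne1$ or $\widetilde d^+(u_m)\ne1$). A corridor is good if $\widetilde d^+(u_1)\ge2$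 and $\widetilde d^-(u_m)\ge2$; an arc is good if it belongs to a good corridor. A face of a polytope $\mathcal P$ is $\mathcal P$ itself or $\mathcal P\cap H$ for a hyperplane $H$ with $\mathcal P$ in one closed side of $H$ (the empty set may be a face); a valid inequality defines the face where it holds with equality; a facet is a proper, inclusion-maximal face.
   Formalization: Points of the flow polytope $\mathcal F(D)$ and of its faces have rational coordinates, lying in ℚ^A rather than $\mathbb R^A$, and the hyperplanes defining faces have rational coefficients. -}

module Defs where

open import Data.Nat using (ℕ; zero; suc)
open import Data.Fin using (Fin; zero; suc; _≟_)
open import Data.List using (List; []; _∷_; _++_; [_])
open import Data.List.Relation.Unary.Unique.Propositional using (Unique)
open import Data.Product using (Σ; ∃; ∃-syntax; _×_; _,_)
open import Data.Sum using (_⊎_)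
open import Data.Unit using (⊤)
open import Data.Empty using (⊥)
open import Data.Bool using (if_then_else_)
open import Relation.Nullary using (¬_; does)
open import Relation.Binary.PropositionalEquality using (_≡_; _≢_)
open import Data.Rational using (ℚ; 0ℚ; 1ℚ; _+_; _*_; _-_; _≤_)
open import Function.Bundles using (_⇔_)

module _ {n m : ℕ} (tl hd : Fin m → Fin n) where

  ArcFromTo : Fin n → Fin n → Set
  ArcFromTo u v = ∃[ a ] (tl a ≡ u × hd a ≡ v)

  Chain : Fin n → List (Fin n) → Set
  Chain u []       = ⊤
  Chain u (v ∷ vs) = ArcFromTo u v × Chain v vs

  OnSeq : Fin m → Fin n → List (Fin n) → Set
  OnSeq a u []       = ⊥
  OnSeq a u (v ∷ vs) = (tl a ≡ u × hd a ≡ v) ⊎ OnSeq a v vs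

  Acyclic : Set
  Acyclic = ∀ (u : Fin n) (vs : List (Fin n)) → ¬ Chain u (vs ++ [ u ])

endOf : {n : ℕ} → Fin n → List (Fin n) → Fin n
endOf u []       = u
endOf u (v ∷ vs) = endOf v vs

record Network : Set where
  field
    n m      : ℕ
    tl hd    : Fin m → Fin n
    s t      : Fin n
    loopless : ∀ a → tl a ≢ hd a
    simple   : ∀ a b → tl a ≡ tl b → hd a ≡ hd b → a ≡ b
    acyclic  : Acyclic tl hd

module _ (D : Network) where
  open Network D

  IsPath : Fin n → List (Fin n) → Set
  IsPath u vs = Chain tl hd u vs × Unique (u ∷ vs)

  -- s–t path, given by the nodes after s
  IsSTPath : List (Fin n) → Set
  IsSTPath vs = IsPath s vs × endOf s vs ≡ t

  InÃ : Fin m → Set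
  InÃ a = ∃[ vs ] (IsSTPath vs × OnSeq tl hd a s vs)

  SingleSTPath : Set
  SingleSTPath = ∃[ vs ] (IsSTPath vs × (∀ ws → IsSTPath ws → ws ≡ vs))

  ExactlyOne : (Fin m → Set) → Set
  ExactlyOne P = ∃[ a ] (P a × (∀ b → P b → b ≡ a))

  AtLeastTwo : (Fin m → Set) → Set
  AtLeastTwo P = ∃[ a ] ∃[ b ] (a ≢ b × P a × P b)

  InArcÃ : Fin n → Fin m → Set
  InArcÃ u b = InÃ b × hd b ≡ u

  OutArcÃ : Fin n → Fin m → Set
  OutArcÃ u b = InÃ b × tl b ≡ u

  Through : Fin n → Set
  Through u = ExactlyOne (InArcÃ u) × ExactlyOne (OutArcÃ u)

  NotThrough : Fin n → Set
  NotThrough u = (¬ ExactlyOne (InArcÃ u)) ⊎ (¬ ExactlyOne (OutArcÃ u))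

  -- the inner nodes u_2..u_{m-1} of u_1 ∷ vs are exactly vs minus its last element
  InnerThrough : List (Fin n) → Set
  InnerThrough []           = ⊤
  InnerThrough (v ∷ [])     = ⊤
  InnerThrough (v ∷ w ∷ ws) = Through v × InnerThrough (w ∷ ws)

  IsCorridor : Fin n → List (Fin n) → Set
  IsCorridor u vs =
    IsPath u vs × (∀ a → OnSeq tl hd a u vs → InÃ a) ×
    InnerThrough vs × NotThrough u × NotThrough (endOf u vs)

  IsGoodCorridor : Fin n → List (Fin n) → Set
  IsGoodCorridor u vs =
    IsCorridor u vs × AtLeastTwo (OutArcÃ u) × AtLeastTwo (InArcÃ (endOf u vs))

  GoodArc : Fin m → Set
  GoodArc a = ∃[ u ] ∃[ vs ] (IsGoodCorridor u vs × OnSeq tl hd a u vs)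

  Σ[_] : ∀ {k} → (Fin k → ℚ) → ℚ
  Σ[_] {zero}  f = 0ℚ
  Σ[_] {suc k} f = f zero + Σ[ (λ i → f (suc i)) ]

  outflow inflow : (Fin m → ℚ) → Fin n → ℚ
  outflow x v = Σ[ (λ a → if does (tl a ≟ v) then x a else 0ℚ) ]
  inflow  x v = Σ[ (λ a → if does (hd a ≟ v) then x a else 0ℚ) ]

  FlowPolytope : (Fin m → ℚ) → Set
  FlowPolytope x =
    (∀ a → 0ℚ ≤ x a) ×
    (∀ v → v ≢ s → v ≢ t → outflow x v - inflow x v ≡ 0ℚ) ×
    (outflow x s - inflow x s ≡ 1ℚ)

module _ {k : ℕ} where

  Region : Set₁
  Region = (Fin k → ℚ) → Set

  _≐_ : Region → Region → Set
  F ≐ G = ∀ x → F x ⇔ G x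

  _⊆_ : Region → Region → Set
  F ⊆ G = ∀ x → F x → G x

  dot : (Fin k → ℚ) → (Fin k → ℚ) → ℚ
  dot c x = sumk (λ i → c i * x i)
    where
      sumk : ∀ {j} → (Fin j → ℚ) → ℚ
      sumk {zero}  f = 0ℚ
      sumk {suc j} f = f zero + sumk (λ i → f (suc i))

  IsFace : Region → Region → Set
  IsFace P F =
    (F ≐ P) ⊎
    Σ (Fin k → ℚ) (λ c → Σ ℚ (λ δ →
      (∃[ i ] (c i ≢ 0ℚ)) ×
      (∀ x → P x → dot c x ≤ δ) ×
      (F ≐ (λ x → P x × dot c x ≡ δ))))

  IsFacet : Region → Region → Set₁
  IsFacet P F =
    IsFace P F × ¬ (F ≐ P) ×
    (∀ G → IsFace P G → ¬ (G ≐ P) → F ⊆ G → G ⊆ F)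

NonnegFace : (D : Network) → Fin (Network.m D) → Region
NonnegFace D a x = FlowPolytope D x × x a ≡ 0ℚ

-- Every point of F(D) is a convex combination of indicator vectors χ(p) of s–t paths p: subtract
-- the bottleneck multiple of an s–t walk along arcs of positive flow (a path, by acyclicity) and
-- recurse. Hence a point with x a > 0 lies on a path through a, and {x a = 0} is a proper face
-- iff a ∈ Ã. All arcs of a corridor lie on the same s–t paths.
--
-- Let {x a = 0} be a facet and let D have two s–t paths. If the start u of the corridor through a
-- had a single outgoing arc in Ã, then either u = s, so a lies on every s–t path, {x a = 0} is
-- empty and maximality leaves a single s–t path; or two arcs of Ã enter u, every path through
-- either of them uses a, and {x a = 0} is strictly contained in the face {x b = 0} of one of them.
-- The end of the corridor is symmetric.
--
-- Conversely, let c·x ≤ δ define a face containing {x a = 0} and a point y with y a > 0. The paths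
-- avoiding a lie on the face, and so does some path through a, carrying y. Exchanging the part of
-- a path through a before (after) the good corridor against the bypass leaving its start (entering
-- its end) shows that all paths through a have the same cost, so all of F(D) lies on the face.

module Submission where

open import Defs
open import Algebra.Bundles using (Ring)
open import Data.Bool using (if_then_else_; _∧_)
open import Data.Empty using (⊥; ⊥-elim)
open import Data.Fin using (Fin; zero; suc; _≟_; punchOut)
import Data.Fin.Properties as Fin
open import Data.List using (List; []; _∷_; _++_; [_]; length)
import Data.List.Properties as List
open import Data.List.Membership.Propositional using (_∈_)
open import Data.List.Membership.Propositional.Properties using (∈-∃++; ∈-++⁺ˡ; ∈-++⁺ʳ)
open import Data.List.Relation.Unary.All using (All; []; _∷_)
open import Data.List.Relation.Unary.All.Properties using (¬Any⇒All¬; All¬⇒¬Any)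
open import Data.List.Relation.Unary.Any using (here; there)
open import Data.List.Relation.Unary.AllPairs using ([]; _∷_)
open import Data.List.Relation.Unary.Unique.Propositional using (Unique)
import Data.List.Relation.Unary.Unique.DecPropositional as UniqueDec
open import Data.Nat as ℕ using (ℕ; zero; suc; z≤n; s≤s)
import Data.Nat.Properties as ℕ
open import Data.Product using (∃; ∃₂; ∃-syntax; _×_; _,_; proj₁; proj₂)
open import Data.Rational using (ℚ; 0ℚ; 1ℚ; _+_; _*_; _-_; -_; _≤_; _<_; _⊓_; positive; nonNegative)
open import Data.Rational.Properties hiding (_≟_)
import Data.Rational.Properties as ℚ
open import Data.Rational.Solver using (module +-*-Solver)
open import Data.Sum using (_⊎_; inj₁; inj₂)
open import Data.Unit using (⊤; tt)
open import Function using (_∘_; flip)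
open import Function.Bundles using (_⇔_; mk⇔; Equivalence)
open import Relation.Binary.Definitions using (tri<; tri≈; tri>)
open import Relation.Binary.PropositionalEquality hiding ([_])
open import Relation.Nullary using (¬_; Dec; yes; no; does)
open import Relation.Nullary.Decidable using (_×-dec_; _⊎-dec_; _→-dec_; ¬?)
open import Algebra.Properties.Group +-0-group using (x∙y⁻¹≈ε⇒x≈y; ∙-cancelˡ; ∙-cancelʳ)
open import Algebra.Properties.Ring +-*-ring using (-1*x≈-x)
open import Algebra.Properties.Semiring.Sum (Ring.semiring +-*-ring)
  using (sum; sum-cong-≗; ∑-distrib-+; ∑-comm; *-distribˡ-sum)
open +-*-Solver

0≤-cases : ∀ {p} → 0ℚ ≤ p → p ≡ 0ℚ ⊎ 0ℚ < p
0≤-cases {p} 0≤p with <-cmp 0ℚ p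
... | tri< 0<p _ _ = inj₂ 0<p
... | tri≈ _ 0≡p _ = inj₁ (sym 0≡p)
... | tri> _ _ p<0 = ⊥-elim (<-irrefl refl (<-≤-trans p<0 0≤p))

0<⇒≢0 : ∀ {p} → 0ℚ < p → p ≢ 0ℚ
0<⇒≢0 0<p p≡0 = <-irrefl (sym p≡0) 0<p

p≤p+0≤ : ∀ {p q} → 0ℚ ≤ q → p ≤ p + q
p≤p+0≤ {p} {q} 0≤q = subst (_≤ p + q) (+-identityʳ p) (+-monoʳ-≤ p 0≤q)

p≤0≤+p : ∀ {p q} → 0ℚ ≤ q → p ≤ q + p
p≤0≤+p {p} {q} 0≤q = subst (p ≤_) (+-comm p q) (p≤p+0≤ 0≤q)

≤⇒0≤- : ∀ {p q} → p ≤ q → 0ℚ ≤ q - p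
≤⇒0≤- {p} {q} p≤q = subst (_≤ q - p) (+-inverseʳ p) (+-monoˡ-≤ (- p) p≤q)

0≤* : ∀ {p q} → 0ℚ ≤ p → 0ℚ ≤ q → 0ℚ ≤ p * q
0≤* {p} {q} 0≤p 0≤q = nonNegative⁻¹ (p * q) {{nonNeg*nonNeg⇒nonNeg p q}}
  where
  instance
    _ = nonNegative 0≤p
    _ = nonNegative 0≤q

0<*≡0 : ∀ {p q} → 0ℚ < p → 0ℚ ≤ q → p * q ≡ 0ℚ → q ≡ 0ℚ
0<*≡0 {p} {q} 0<p 0≤q pq≡0 with 0≤-cases 0≤q
... | inj₁ q≡0 = q≡0
... | inj₂ 0<q = ⊥-elim (0<⇒≢0 0<pq pq≡0)
  where
  instance
    _ = positive 0<p
    _ = positive 0<q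
  0<pq : 0ℚ < p * q
  0<pq = positive⁻¹ (p * q) {{pos*pos⇒pos p q}}

sub≡0⇒≡ : ∀ {p q} → p - q ≡ 0ℚ → p ≡ q
sub≡0⇒≡ {p} {q} = x∙y⁻¹≈ε⇒x≈y p q

0<1 : 0ℚ < 1ℚ
0<1 = positive⁻¹ 1ℚ

sum-zero : ∀ {k} (f : Fin k → ℚ) → (∀ i → f i ≡ 0ℚ) → sum f ≡ 0ℚ
sum-zero {zero}  f f≡0 = refl
sum-zero {suc k} f f≡0 =
  trans (cong₂ _+_ (f≡0 zero) (sum-zero (λ i → f (suc i)) (λ i → f≡0 (suc i)))) (+-identityʳ 0ℚ)

sum-single : ∀ {k} (f : Fin k → ℚ) j → (∀ i → i ≢ j → f i ≡ 0ℚ) → sum f ≡ f j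
sum-single {suc k} f zero    off =
  trans (cong (f zero +_) (sum-zero _ (λ i → off (suc i) λ ()))) (+-identityʳ _)
sum-single {suc k} f (suc j) off =
  trans (cong₂ _+_ (off zero λ ()) (sum-single _ j (λ i i≢j → off (suc i) (i≢j ∘ Fin.suc-injective))))
        (+-identityˡ _)

sum-pair : ∀ {k} (f : Fin k → ℚ) j l → j ≢ l → (∀ i → i ≢ j → i ≢ l → f i ≡ 0ℚ) → sum f ≡ f j + f l
sum-pair f zero zero j≢l _ = ⊥-elim (j≢l refl)
sum-pair f zero (suc l) _ off =
  cong (f zero +_) (sum-single _ l (λ i i≢l → off (suc i) (λ ()) (i≢l ∘ Fin.suc-injective)))
sum-pair f (suc j) zero _ off =
  trans (cong (f zero +_) (sum-single _ j (λ i i≢j → off (suc i) (i≢j ∘ Fin.suc-injective) (λ ()))))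
        (+-comm (f zero) _)
sum-pair f (suc j) (suc l) j≢l off =
  trans (cong₂ _+_ (off zero (λ ()) (λ ()))
                   (sum-pair _ j l (j≢l ∘ cong suc)
                     (λ i i≢j i≢l → off (suc i) (i≢j ∘ Fin.suc-injective) (i≢l ∘ Fin.suc-injective))))
        (+-identityˡ _)

∑-distrib-- : ∀ {k} (f g : Fin k → ℚ) → sum (λ i → f i - g i) ≡ sum f - sum g
∑-distrib-- {zero}  f g = sym (+-inverseʳ 0ℚ)
∑-distrib-- {suc k} f g =
  trans (cong (f zero - g zero +_) (∑-distrib-- (λ i → f (suc i)) (λ i → g (suc i))))
        (solve 4 (λ a b c d → (a :- b) :+ (c :- d) := (a :+ c) :- (b :+ d)) refl (f zero) (g zero) _ _)

sum-nonNeg : ∀ {k} (f : Fin k → ℚ) → (∀ i → 0ℚ ≤ f i) → 0ℚ ≤ sum f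
sum-nonNeg {zero}  f 0≤f = ≤-refl
sum-nonNeg {suc k} f 0≤f = +-mono-≤ (0≤f zero) (sum-nonNeg _ (λ i → 0≤f (suc i)))

term≤sum : ∀ {k} (f : Fin k → ℚ) → (∀ i → 0ℚ ≤ f i) → ∀ j → f j ≤ sum f
term≤sum {suc k} f 0≤f zero    = p≤p+0≤ (sum-nonNeg _ (λ i → 0≤f (suc i)))
term≤sum {suc k} f 0≤f (suc j) = ≤-trans (term≤sum _ (λ i → 0≤f (suc i)) j) (p≤0≤+p (0≤f zero))

0<sum⇒0<term : ∀ {k} (f : Fin k → ℚ) → (∀ i → 0ℚ ≤ f i) → 0ℚ < sum f → ∃[ j ] 0ℚ < f j
0<sum⇒0<term {zero}  f 0≤f 0<∑ = ⊥-elim (<-irrefl refl 0<∑)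
0<sum⇒0<term {suc k} f 0≤f 0<∑ with 0≤-cases (0≤f zero)
... | inj₂ 0<f₀ = zero , 0<f₀
... | inj₁ f₀≡0 =
  let j , 0<fⱼ = 0<sum⇒0<term (λ i → f (suc i)) (λ i → 0≤f (suc i))
                   (subst (0ℚ <_) (trans (cong (_+ sum (λ i → f (suc i))) f₀≡0) (+-identityˡ _)) 0<∑)
  in suc j , 0<fⱼ

nonzero : ℚ → ℕ
nonzero q = if does (q ℚ.≟ 0ℚ) then 0 else 1

∣supp∣ : ∀ {k} → (Fin k → ℚ) → ℕ
∣supp∣ {zero}  f = 0
∣supp∣ {suc k} f = nonzero (f zero) ℕ.+ ∣supp∣ (λ i → f (suc i))

nonzero-mono : ∀ p q → (p ≡ 0ℚ → q ≡ 0ℚ) → nonzero q ℕ.≤ nonzero p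
nonzero-mono p q p≡0⇒q≡0 with p ℚ.≟ 0ℚ | q ℚ.≟ 0ℚ
... | yes p≡0 | no q≢0 = ⊥-elim (q≢0 (p≡0⇒q≡0 p≡0))
... | yes _   | yes _  = z≤n
... | no _    | yes _  = z≤n
... | no _    | no _   = s≤s z≤n

nonzero-drop : ∀ p q → p ≢ 0ℚ → q ≡ 0ℚ → nonzero q ℕ.< nonzero p
nonzero-drop p q p≢0 q≡0 with p ℚ.≟ 0ℚ | q ℚ.≟ 0ℚ
... | yes p≡0 | _      = ⊥-elim (p≢0 p≡0)
... | no _    | yes _  = s≤s z≤n
... | no _    | no q≢0 = ⊥-elim (q≢0 q≡0)

∣supp∣-mono : ∀ {k} (f g : Fin k → ℚ) → (∀ i → f i ≡ 0ℚ → g i ≡ 0ℚ) → ∣supp∣ g ℕ.≤ ∣supp∣ f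
∣supp∣-mono {zero}  f g zeros = z≤n
∣supp∣-mono {suc k} f g zeros =
  ℕ.+-mono-≤ (nonzero-mono _ _ (zeros zero)) (∣supp∣-mono _ _ (λ i → zeros (suc i)))

∣supp∣-shrink : ∀ {k} (f g : Fin k → ℚ) → (∀ i → f i ≡ 0ℚ → g i ≡ 0ℚ) →
                ∀ j → f j ≢ 0ℚ → g j ≡ 0ℚ → ∣supp∣ g ℕ.< ∣supp∣ f
∣supp∣-shrink {suc k} f g zeros zero    fⱼ≢0 gⱼ≡0 =
  ℕ.+-mono-<-≤ (nonzero-drop _ _ fⱼ≢0 gⱼ≡0) (∣supp∣-mono _ _ (λ i → zeros (suc i)))
∣supp∣-shrink {suc k} f g zeros (suc j) fⱼ≢0 gⱼ≡0 =
  ℕ.+-mono-≤-< (nonzero-mono _ _ (zeros zero)) (∣supp∣-shrink _ _ (λ i → zeros (suc i)) j fⱼ≢0 gⱼ≡0)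

module _ {A : Set} where

  weighted : (A → ℚ) → List (ℚ × A) → ℚ
  weighted f []             = 0ℚ
  weighted f ((μ , a) ∷ ts) = μ * f a + weighted f ts

  totalWeight : List (ℚ × A) → ℚ
  totalWeight []             = 0ℚ
  totalWeight ((μ , _) ∷ ts) = μ + totalWeight ts

  NonNegTerms : (A → ℚ) → List (ℚ × A) → Set
  NonNegTerms f ts = ∀ {μ a} → (μ , a) ∈ ts → 0ℚ ≤ μ * f a

  private
    nonNegTerms-tail : ∀ {f t ts} → NonNegTerms f (t ∷ ts) → NonNegTerms f ts
    nonNegTerms-tail nn t∈ = nn (there t∈)

  weighted-nonNeg : ∀ f ts → NonNegTerms f ts → 0ℚ ≤ weighted f ts
  weighted-nonNeg f []             nn = ≤-refl
  weighted-nonNeg f ((μ , a) ∷ ts) nn = +-mono-≤ (nn (here refl)) (weighted-nonNeg f ts (nonNegTerms-tail nn))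

  term≤weighted : ∀ f ts → NonNegTerms f ts → ∀ {μ a} → (μ , a) ∈ ts → μ * f a ≤ weighted f ts
  term≤weighted f ((μ , a) ∷ ts) nn (here refl) = p≤p+0≤ (weighted-nonNeg f ts (nonNegTerms-tail nn))
  term≤weighted f (_ ∷ ts)       nn (there t∈)  =
    ≤-trans (term≤weighted f ts (nonNegTerms-tail nn) t∈) (p≤0≤+p (nn (here refl)))

  0<weighted⇒term : ∀ f ts → NonNegTerms f ts → 0ℚ < weighted f ts →
                    ∃₂ λ μ a → (μ , a) ∈ ts × 0ℚ < μ * f a
  0<weighted⇒term f []             nn 0<w = ⊥-elim (<-irrefl refl 0<w)
  0<weighted⇒term f ((μ , a) ∷ ts) nn 0<w with 0≤-cases (nn (here refl))
  ... | inj₂ 0<μfa = μ , a , here refl , 0<μfa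
  ... | inj₁ μfa≡0 =
    let μ′ , a′ , t∈ , 0<μ′fa′ = 0<weighted⇒term f ts (nonNegTerms-tail nn)
                                   (subst (0ℚ <_) (trans (cong (_+ weighted f ts) μfa≡0) (+-identityˡ _)) 0<w)
    in μ′ , a′ , there t∈ , 0<μ′fa′

  weighted≡0⇒terms≡0 : ∀ f ts → NonNegTerms f ts → weighted f ts ≡ 0ℚ →
                       ∀ {μ a} → (μ , a) ∈ ts → μ * f a ≡ 0ℚ
  weighted≡0⇒terms≡0 f ts nn w≡0 t∈ = ≤-antisym (subst (_ ≤_) w≡0 (term≤weighted f ts nn t∈)) (nn t∈)

  weighted-const : ∀ δ ts → weighted (λ _ → δ) ts ≡ totalWeight ts * δ
  weighted-const δ []             = sym (*-zeroˡ δ)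
  weighted-const δ ((μ , _) ∷ ts) =
    trans (cong (μ * δ +_) (weighted-const δ ts)) (sym (*-distribʳ-+ δ μ (totalWeight ts)))

  weighted-- : ∀ f g ts → weighted (λ a → f a - g a) ts ≡ weighted f ts - weighted g ts
  weighted-- f g []             = sym (+-inverseʳ 0ℚ)
  weighted-- f g ((μ , a) ∷ ts) =
    trans (cong (μ * (f a - g a) +_) (weighted-- f g ts))
      (solve 5 (λ l x y p q → l :* (x :- y) :+ (p :- q) := (l :* x :+ p) :- (l :* y :+ q)) refl
               μ (f a) (g a) (weighted f ts) (weighted g ts))

  weighted-cong : ∀ f g ts → (∀ {μ a} → (μ , a) ∈ ts → f a ≡ g a) → weighted f ts ≡ weighted g ts
  weighted-cong f g []             _  = refl
  weighted-cong f g ((μ , a) ∷ ts) eq =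
    cong₂ (λ p q → μ * p + q) (eq (here refl)) (weighted-cong f g ts (eq ∘ there))

  weighted≡bound⇒terms≡bound : ∀ f δ ts → (∀ {μ a} → (μ , a) ∈ ts → 0ℚ < μ) → totalWeight ts ≡ 1ℚ →
                               (∀ {μ a} → (μ , a) ∈ ts → f a ≤ δ) → weighted f ts ≡ δ →
                               ∀ {μ a} → (μ , a) ∈ ts → f a ≡ δ
  weighted≡bound⇒terms≡bound f δ ts 0<μ total≡1 f≤δ w≡δ {μ} {a} t∈ =
    sym (sub≡0⇒≡ (0<*≡0 (0<μ t∈) (≤⇒0≤- (f≤δ t∈)) (weighted≡0⇒terms≡0 gap ts gap-nonNeg gap≡0 t∈)))
    where
    gap : A → ℚ
    gap a = δ - f a
    gap-nonNeg : NonNegTerms gap ts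
    gap-nonNeg t∈ = 0≤* (<⇒≤ (0<μ t∈)) (≤⇒0≤- (f≤δ t∈))
    gap≡0 : weighted gap ts ≡ 0ℚ
    gap≡0 = begin
      weighted gap ts                           ≡⟨ weighted-- (λ _ → δ) f ts ⟩
      weighted (λ _ → δ) ts - weighted f ts     ≡⟨ cong₂ _-_ (weighted-const δ ts) w≡δ ⟩
      totalWeight ts * δ - δ                    ≡⟨ cong (λ w → w * δ - δ) total≡1 ⟩
      1ℚ * δ - δ                                ≡⟨ cong (_- δ) (*-identityˡ δ) ⟩
      δ - δ                                     ≡⟨ +-inverseʳ δ ⟩
      0ℚ                                        ∎
      where open ≡-Reasoning

dot≡sum : ∀ {k} (c x : Fin k → ℚ) → dot c x ≡ sum (λ i → c i * x i)
dot≡sum {zero}  c x = refl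
dot≡sum {suc k} c x = cong (c zero * x zero +_) (dot≡sum (λ i → c (suc i)) (λ i → x (suc i)))

dot-cong : ∀ {k} (c : Fin k → ℚ) {x y : Fin k → ℚ} → (∀ i → x i ≡ y i) → dot c x ≡ dot c y
dot-cong c {x} {y} x≗y =
  trans (dot≡sum c x) (trans (sum-cong-≗ (λ i → cong (c i *_) (x≗y i))) (sym (dot≡sum c y)))

dot-zero : ∀ {k} (c : Fin k → ℚ) → dot c (λ _ → 0ℚ) ≡ 0ℚ
dot-zero c = trans (dot≡sum c _) (sum-zero _ (λ i → *-zeroʳ (c i)))

dot-+ : ∀ {k} (c y z : Fin k → ℚ) → dot c (λ i → y i + z i) ≡ dot c y + dot c z
dot-+ c y z = begin
  dot c (λ i → y i + z i)                        ≡⟨ dot≡sum c _ ⟩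
  sum (λ i → c i * (y i + z i))                  ≡⟨ sum-cong-≗ (λ i → *-distribˡ-+ (c i) (y i) (z i)) ⟩
  sum (λ i → c i * y i + c i * z i)              ≡⟨ ∑-distrib-+ (λ i → c i * y i) (λ i → c i * z i) ⟩
  sum (λ i → c i * y i) + sum (λ i → c i * z i)  ≡⟨ sym (cong₂ _+_ (dot≡sum c y) (dot≡sum c z)) ⟩
  dot c y + dot c z                              ∎
  where open ≡-Reasoning

dot-* : ∀ {k} (c y : Fin k → ℚ) μ → dot c (λ i → μ * y i) ≡ μ * dot c y
dot-* c y μ = begin
  dot c (λ i → μ * y i)        ≡⟨ dot≡sum c _ ⟩
  sum (λ i → c i * (μ * y i))  ≡⟨ sum-cong-≗ (λ i → left-comm (c i) μ (y i)) ⟩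
  sum (λ i → μ * (c i * y i))  ≡⟨ sym (*-distribˡ-sum μ (λ i → c i * y i)) ⟩
  μ * sum (λ i → c i * y i)    ≡⟨ cong (μ *_) (sym (dot≡sum c y)) ⟩
  μ * dot c y                  ∎
  where
  open ≡-Reasoning
  left-comm : ∀ p q r → p * (q * r) ≡ q * (p * r)
  left-comm = solve 3 (λ p q r → p :* (q :* r) := q :* (p :* r)) refl

dot-weighted : ∀ {A : Set} {k} (c : Fin k → ℚ) (g : A → Fin k → ℚ) ts →
               dot c (λ i → weighted (λ a → g a i) ts) ≡ weighted (λ a → dot c (g a)) ts
dot-weighted c g []             = dot-zero c
dot-weighted c g ((μ , a) ∷ ts) =
  trans (dot-+ c (λ i → μ * g a i) _) (cong₂ _+_ (dot-* c (g a) μ) (dot-weighted c g ts))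

scaledUnit : ∀ {k} → ℚ → Fin k → Fin k → ℚ
scaledUnit κ j i = if does (i ≟ j) then κ else 0ℚ

dot-scaledUnit : ∀ {k} κ (j : Fin k) x → dot (scaledUnit κ j) x ≡ κ * x j
dot-scaledUnit κ j x =
  trans (dot≡sum (scaledUnit κ j) x) (trans (sum-single (λ i → scaledUnit κ j i * x i) j off) on)
  where
  off : ∀ i → i ≢ j → scaledUnit κ j i * x i ≡ 0ℚ
  off i i≢j with i ≟ j
  ... | yes i≡j = ⊥-elim (i≢j i≡j)
  ... | no _    = *-zeroˡ (x i)
  on : scaledUnit κ j j * x j ≡ κ * x j
  on with j ≟ j
  ... | yes _  = refl
  ... | no j≢j = ⊥-elim (j≢j refl)

module _ {n m : ℕ} (end : Fin m → Fin n) where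

  at : Fin n → (Fin m → ℚ) → Fin m → ℚ
  at w x b = if does (end b ≟ w) then x b else 0ℚ

  incident : (Fin m → ℚ) → Fin n → ℚ
  incident x w = sum (at w x)

  at-on : ∀ {w} x b → end b ≡ w → at w x b ≡ x b
  at-on {w} x b eb≡w with end b ≟ w
  ... | yes _   = refl
  ... | no eb≢w = ⊥-elim (eb≢w eb≡w)

  at-off : ∀ {w} x b → end b ≢ w → at w x b ≡ 0ℚ
  at-off {w} x b eb≢w with end b ≟ w
  ... | yes eb≡w = ⊥-elim (eb≢w eb≡w)
  ... | no _     = refl

  at-cases : ∀ w x b → (end b ≡ w × at w x b ≡ x b) ⊎ at w x b ≡ 0ℚ
  at-cases w x b with end b ≟ w
  ... | yes eb≡w = inj₁ (eb≡w , refl)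
  ... | no _     = inj₂ refl

  at-zero : ∀ w x b → x b ≡ 0ℚ → at w x b ≡ 0ℚ
  at-zero w x b xb≡0 with at-cases w x b
  ... | inj₁ (_ , at≡x) = trans at≡x xb≡0
  ... | inj₂ at≡0       = at≡0

  at-nonNeg : ∀ w x b → 0ℚ ≤ x b → 0ℚ ≤ at w x b
  at-nonNeg w x b 0≤xb with at-cases w x b
  ... | inj₁ (_ , at≡x) = subst (0ℚ ≤_) (sym at≡x) 0≤xb
  ... | inj₂ at≡0       = ≤-reflexive (sym at≡0)

  incident-lin : ∀ x y c w → incident (λ b → x b - c * y b) w ≡ incident x w - c * incident y w
  incident-lin x y c w = begin
    sum (at w (λ b → x b - c * y b))          ≡⟨ sum-cong-≗ pointwise ⟩
    sum (λ b → at w x b - c * at w y b)       ≡⟨ ∑-distrib-- (at w x) _ ⟩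
    sum (at w x) - sum (λ b → c * at w y b)   ≡⟨ cong (λ q → sum (at w x) - q) (sym (*-distribˡ-sum c (at w y))) ⟩
    sum (at w x) - c * sum (at w y)           ∎
    where
    open ≡-Reasoning
    pointwise : ∀ b → at w (λ b → x b - c * y b) b ≡ at w x b - c * at w y b
    pointwise b with end b ≟ w
    ... | yes _ = refl
    ... | no _  = solve 1 (λ c → con 0ℚ := con 0ℚ :- c :* con 0ℚ) refl c

  incident-+ : ∀ x y w → incident (λ b → x b + y b) w ≡ incident x w + incident y w
  incident-+ x y w = trans (sum-cong-≗ pointwise) (∑-distrib-+ (at w x) (at w y))
    where
    pointwise : ∀ b → at w (λ b → x b + y b) b ≡ at w x b + at w y b
    pointwise b with end b ≟ w
    ... | yes _ = refl
    ... | no _  = sym (+-identityʳ 0ℚ)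

  incident-zero : ∀ x w → (∀ b → x b ≡ 0ℚ) → incident x w ≡ 0ℚ
  incident-zero x w x≡0 = sum-zero _ (λ b → at-zero w x b (x≡0 b))

  incident-single : ∀ x w e → (∀ b → b ≢ e → x b ≡ 0ℚ) → incident x w ≡ at w x e
  incident-single x w e off = sum-single _ e (λ b b≢e → at-zero w x b (off b b≢e))

  incident-nonNeg : ∀ x w → (∀ b → 0ℚ ≤ x b) → 0ℚ ≤ incident x w
  incident-nonNeg x w 0≤x = sum-nonNeg _ (λ b → at-nonNeg w x b (0≤x b))

  arc≤incident : ∀ x → (∀ b → 0ℚ ≤ x b) → ∀ b → x b ≤ incident x (end b)
  arc≤incident x 0≤x b =
    subst (_≤ incident x (end b)) (at-on x b refl) (term≤sum _ (λ b′ → at-nonNeg (end b) x b′ (0≤x b′)) b)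

  0<incident⇒arc : ∀ x w → (∀ b → 0ℚ ≤ x b) → 0ℚ < incident x w → ∃[ b ] (end b ≡ w × 0ℚ < x b)
  0<incident⇒arc x w 0≤x 0<in with 0<sum⇒0<term _ (λ b → at-nonNeg w x b (0≤x b)) 0<in
  ... | b , 0<at with at-cases w x b
  ...   | inj₁ (eb≡w , at≡x) = b , eb≡w , subst (0ℚ <_) at≡x 0<at
  ...   | inj₂ at≡0          = ⊥-elim (0<⇒≢0 0<at at≡0)

  ∑-incident : ∀ x → sum (incident x) ≡ sum x
  ∑-incident x = trans (∑-comm (λ w b → at w x b)) (sum-cong-≗ (λ b →
    trans (sum-single (λ w → at w x b) (end b) (λ w w≢eb → at-off x b (w≢eb ∘ sym))) (at-on x b refl)))

unique⇒length≤ : ∀ {n} (xs : List (Fin n)) → Unique xs → length xs ℕ.≤ n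
unique⇒length≤ []       _ = z≤n
unique⇒length≤ {zero}  (() ∷ _) _
unique⇒length≤ {suc n} (x ∷ xs) (x∉xs ∷ uxs) =
  s≤s (subst (ℕ._≤ n) (length-squeeze xs x∉xs)
             (unique⇒length≤ (squeeze xs x∉xs) (squeeze-unique xs x∉xs uxs)))
  where
  squeeze : ∀ ys → All (x ≢_) ys → List (Fin n)
  squeeze []       []         = []
  squeeze (y ∷ ys) (x≢y ∷ ps) = punchOut x≢y ∷ squeeze ys ps

  length-squeeze : ∀ ys ps → length (squeeze ys ps) ≡ length ys
  length-squeeze []       []       = refl
  length-squeeze (y ∷ ys) (_ ∷ ps) = cong suc (length-squeeze ys ps)

  squeeze-≢ : ∀ {y} (x≢y : x ≢ y) ys ps → All (y ≢_) ys → All (punchOut x≢y ≢_) (squeeze ys ps)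
  squeeze-≢ x≢y []       []          []            = []
  squeeze-≢ x≢y (z ∷ zs) (x≢z ∷ ps) (y≢z ∷ y∉zs) =
    (y≢z ∘ Fin.punchOut-injective x≢y x≢z) ∷ squeeze-≢ x≢y zs ps y∉zs

  squeeze-unique : ∀ ys ps → Unique ys → Unique (squeeze ys ps)
  squeeze-unique []       []          []            = []
  squeeze-unique (y ∷ ys) (x≢y ∷ ps) (y∉ys ∷ uys) = squeeze-≢ x≢y ys ps y∉ys ∷ squeeze-unique ys ps uys

disjoint-++ : ∀ {A : Set} {x : A} xs ys → Unique (xs ++ ys) → x ∈ xs → ¬ x ∈ ys
disjoint-++ (z ∷ xs) ys (z∉ ∷ _) (here refl) x∈ys = All¬⇒¬Any z∉ (∈-++⁺ʳ xs x∈ys)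
disjoint-++ (z ∷ xs) ys (_ ∷ u)  (there x∈xs) x∈ys = disjoint-++ xs ys u x∈xs x∈ys

unique-++ʳ : ∀ {A : Set} (xs ys : List A) → Unique (xs ++ ys) → Unique ys
unique-++ʳ []       ys u       = u
unique-++ʳ (x ∷ xs) ys (_ ∷ u) = unique-++ʳ xs ys u

bounded-∃? : ∀ {n} k (Q : List (Fin n) → Set) → (∀ vs → Dec (Q vs)) → (∀ vs → Q vs → length vs ℕ.≤ k) →
             Dec (∃ Q)
bounded-∃? k Q Q? bound with Q? []
... | yes q = yes ([] , q)
bounded-∃? zero    Q Q? bound | no ¬q =
  no λ { ([] , q) → ¬q q ; (_ ∷ _ , q) → ℕ.1+n≰n (ℕ.≤-trans (bound _ q) z≤n) }
bounded-∃? (suc k) Q Q? bound | no ¬q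
  with Fin.any? (λ x → bounded-∃? k (Q ∘ (x ∷_)) (Q? ∘ (x ∷_)) (λ vs q → ℕ.≤-pred (bound _ q)))
... | yes (x , vs , q) = yes (x ∷ vs , q)
... | no ¬x            = no λ { ([] , q) → ¬q q ; (x ∷ vs , q) → ¬x (x , vs , q) }

endOf-++ : ∀ {n} (u : Fin n) xs ys → endOf u (xs ++ ys) ≡ endOf (endOf u xs) ys
endOf-++ u []       ys = refl
endOf-++ u (x ∷ xs) ys = endOf-++ x xs ys

endOf-∷ʳ : ∀ {n} (u : Fin n) xs w → endOf u (xs ++ [ w ]) ≡ w
endOf-∷ʳ u xs w = endOf-++ u xs [ w ]

endOf∈ : ∀ {n} (u v : Fin n) vs → endOf u (v ∷ vs) ∈ v ∷ vs
endOf∈ u v []       = here refl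
endOf∈ u v (w ∷ vs) = there (endOf∈ v w vs)

module Walks {n : ℕ} (R : Fin n → Fin n → Set) where

  RChain : Fin n → List (Fin n) → Set
  RChain u []       = ⊤
  RChain u (v ∷ vs) = R u v × RChain v vs

  RChain-++ : ∀ u xs ys → RChain u xs → RChain (endOf u xs) ys → RChain u (xs ++ ys)
  RChain-++ u []       ys _         c = c
  RChain-++ u (x ∷ xs) ys (r , cxs) c = r , RChain-++ x xs ys cxs c

  RChain-++ˡ : ∀ u xs ys → RChain u (xs ++ ys) → RChain u xs
  RChain-++ˡ u []       ys _       = tt
  RChain-++ˡ u (x ∷ xs) ys (r , c) = r , RChain-++ˡ x xs ys c

  RChain-last : ∀ u w ws → RChain u (w ∷ ws) → ∃[ z ] R z (endOf w ws)
  RChain-last u w []        (r , _) = u , r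
  RChain-last u w (w′ ∷ ws) (_ , c) = RChain-last w w′ ws c

  NoCycle : Set
  NoCycle = ∀ u vs → ¬ RChain u (vs ++ [ u ])

  module _ (noCycle : NoCycle) where

    no-return : ∀ u vs x → RChain u vs → R (endOf u vs) x → ¬ x ∈ u ∷ vs
    no-return u vs       .u c r (here refl) = noCycle u vs (RChain-++ u vs [ u ] c (r , tt))
    no-return u (v ∷ vs) x  (_ , c) r (there x∈vs) = no-return v vs x c r x∈vs

    start∉ : ∀ u vs → RChain u vs → ¬ u ∈ vs
    start∉ u vs c u∈vs with ∈-∃++ u∈vs
    ... | ys , zs , refl =
      noCycle u ys (RChain-++ˡ u (ys ++ [ u ]) zs (subst (RChain u) (sym (List.++-assoc ys [ u ] zs)) c))

    RChain-unique : ∀ u vs → RChain u vs → Unique (u ∷ vs)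
    RChain-unique u []       _       = [] ∷ []
    RChain-unique u (v ∷ vs) (r , c) = ¬Any⇒All¬ (v ∷ vs) (start∉ u (v ∷ vs) (r , c)) ∷ RChain-unique v vs c

    -- Acyclicity bounds the length of the walk by n, which serves as fuel.
    walk-to : (Stop Good : Fin n → Set) → (∀ u → Dec (Stop u)) →
              (∀ u → Good u → ¬ Stop u → ∃[ w ] (R u w × (Stop w ⊎ Good w))) →
              ∀ u → Good u → ∃[ ws ] (RChain u ws × Stop (endOf u ws))
    walk-to Stop Good stop? step u good = go n [] tt good (ℕ.≤-reflexive (sym (ℕ.+-identityʳ n)))
      where
      go : ∀ fuel vs → RChain u vs → Good (endOf u vs) → n ℕ.≤ fuel ℕ.+ length vs →
           ∃[ ws ] (RChain u ws × Stop (endOf u ws))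
      go fuel vs c g bound with stop? (endOf u vs)
      ... | yes st = vs , c , st
      ... | no ¬st with step (endOf u vs) g ¬st
      ...   | w , r , inj₁ st = vs ++ [ w ] , RChain-++ u vs [ w ] c (r , tt) , subst Stop (sym (endOf-∷ʳ u vs w)) st
      go zero       vs c g bound | no ¬st | w , r , inj₂ g′ =
        ⊥-elim (ℕ.<-irrefl refl (ℕ.≤-trans (s≤s bound) (unique⇒length≤ (u ∷ vs) (RChain-unique u vs c))))
      go (suc fuel) vs c g bound | no ¬st | w , r , inj₂ g′ =
        go fuel (vs ++ [ w ]) (RChain-++ u vs [ w ] c (r , tt)) (subst Good (sym (endOf-∷ʳ u vs w)) g′)
           (subst (n ℕ.≤_) (trans (sym (ℕ.+-suc fuel (length vs)))
                             (cong (fuel ℕ.+_) (trans (ℕ.+-comm 1 (length vs)) (sym (List.length-++ vs))))) bound)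

open Walks

RChain-map : ∀ {n} {R R′ : Fin n → Fin n → Set} → (∀ {u v} → R u v → R′ u v) →
             ∀ u vs → RChain R u vs → RChain R′ u vs
RChain-map f u []       _       = tt
RChain-map f u (v ∷ vs) (r , c) = f r , RChain-map f v vs c

module _ {n m : ℕ} {tl hd : Fin m → Fin n} where

  Chain⇒RChain : ∀ u vs → Chain tl hd u vs → RChain (ArcFromTo tl hd) u vs
  Chain⇒RChain u []       _       = tt
  Chain⇒RChain u (v ∷ vs) (r , c) = r , Chain⇒RChain v vs c

  RChain⇒Chain : ∀ u vs → RChain (ArcFromTo tl hd) u vs → Chain tl hd u vs
  RChain⇒Chain u []       _       = tt
  RChain⇒Chain u (v ∷ vs) (r , c) = r , RChain⇒Chain v vs c

  chain-++ : ∀ u xs ys → Chain tl hd u xs → Chain tl hd (endOf u xs) ys → Chain tl hd u (xs ++ ys)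
  chain-++ u []       ys _         c = c
  chain-++ u (x ∷ xs) ys (r , cxs) c = r , chain-++ x xs ys cxs c

  chain-++ˡ : ∀ u xs ys → Chain tl hd u (xs ++ ys) → Chain tl hd u xs
  chain-++ˡ u []       ys _       = tt
  chain-++ˡ u (x ∷ xs) ys (r , c) = r , chain-++ˡ x xs ys c

  chain-++ʳ : ∀ u xs ys → Chain tl hd u (xs ++ ys) → Chain tl hd (endOf u xs) ys
  chain-++ʳ u []       ys c       = c
  chain-++ʳ u (x ∷ xs) ys (_ , c) = chain-++ʳ x xs ys c

  onSeq? : ∀ b u vs → Dec (OnSeq tl hd b u vs)
  onSeq? b u []       = no λ ()
  onSeq? b u (v ∷ vs) = ((tl b ≟ u) ×-dec (hd b ≟ v)) ⊎-dec onSeq? b v vs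

  onSeq-++⁻ : ∀ b u xs ys → OnSeq tl hd b u (xs ++ ys) → OnSeq tl hd b u xs ⊎ OnSeq tl hd b (endOf u xs) ys
  onSeq-++⁻ b u []       ys o        = inj₂ o
  onSeq-++⁻ b u (x ∷ xs) ys (inj₁ e) = inj₁ (inj₁ e)
  onSeq-++⁻ b u (x ∷ xs) ys (inj₂ o) with onSeq-++⁻ b x xs ys o
  ... | inj₁ o′ = inj₁ (inj₂ o′)
  ... | inj₂ o′ = inj₂ o′

  onSeq-++⁺ˡ : ∀ b u xs ys → OnSeq tl hd b u xs → OnSeq tl hd b u (xs ++ ys)
  onSeq-++⁺ˡ b u (x ∷ xs) ys (inj₁ e) = inj₁ e
  onSeq-++⁺ˡ b u (x ∷ xs) ys (inj₂ o) = inj₂ (onSeq-++⁺ˡ b x xs ys o)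

  onSeq-++⁺ʳ : ∀ b u xs ys → OnSeq tl hd b (endOf u xs) ys → OnSeq tl hd b u (xs ++ ys)
  onSeq-++⁺ʳ b u []       ys o = o
  onSeq-++⁺ʳ b u (x ∷ xs) ys o = inj₂ (onSeq-++⁺ʳ b x xs ys o)

  onSeq⇒tl∈ : ∀ b u vs → OnSeq tl hd b u vs → tl b ∈ u ∷ vs
  onSeq⇒tl∈ b u (v ∷ vs) (inj₁ (tb≡u , _)) = here tb≡u
  onSeq⇒tl∈ b u (v ∷ vs) (inj₂ o)          = there (onSeq⇒tl∈ b v vs o)

  onSeq⇒hd∈ : ∀ b u vs → OnSeq tl hd b u vs → hd b ∈ vs
  onSeq⇒hd∈ b u (v ∷ vs) (inj₁ (_ , hb≡v)) = here hb≡v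
  onSeq⇒hd∈ b u (v ∷ vs) (inj₂ o)          = there (onSeq⇒hd∈ b v vs o)

  onSeq-split : ∀ b u vs → OnSeq tl hd b u vs → ∃₂ λ q r → vs ≡ q ++ hd b ∷ r × endOf u q ≡ tl b
  onSeq-split b u (v ∷ vs) (inj₁ (tb≡u , hb≡v)) = [] , vs , cong (_∷ vs) (sym hb≡v) , sym tb≡u
  onSeq-split b u (v ∷ vs) (inj₂ o) with onSeq-split b v vs o
  ... | q , r , vs≡ , end≡ = v ∷ q , r , cong (v ∷_) vs≡ , end≡

  ∈⇒onSeq-hd : ∀ u vs x → Chain tl hd u vs → x ∈ vs → ∃[ b ] (OnSeq tl hd b u vs × hd b ≡ x)
  ∈⇒onSeq-hd u (w ∷ ws) x ((b , tb≡u , hb≡w) , _) (here x≡w) = b , inj₁ (tb≡u , hb≡w) , trans hb≡w (sym x≡w)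
  ∈⇒onSeq-hd u (w ∷ ws) x (_ , c) (there x∈ws) =
    let b , o , hb≡x = ∈⇒onSeq-hd w ws x c x∈ws in b , inj₂ o , hb≡x

  last-onSeq : ∀ u w ws → Chain tl hd u (w ∷ ws) → ∃[ b ] (OnSeq tl hd b u (w ∷ ws) × hd b ≡ endOf w ws)
  last-onSeq u w []        ((b , tb≡u , hb≡w) , _) = b , inj₁ (tb≡u , hb≡w) , hb≡w
  last-onSeq u w (w′ ∷ ws) (_ , c) =
    let b , o , hb≡end = last-onSeq w w′ ws c in b , inj₂ o , hb≡end

  succ-onSeq : ∀ u vs b → Chain tl hd u vs → OnSeq tl hd b u vs → hd b ≢ endOf u vs →
               ∃[ b′ ] (OnSeq tl hd b′ u vs × tl b′ ≡ hd b)
  succ-onSeq u (v ∷ [])     b c (inj₁ (_ , hb≡v)) hb≢end = ⊥-elim (hb≢end hb≡v)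
  succ-onSeq u (v ∷ w ∷ ws) b (_ , (b′ , tb′≡v , hb′≡w) , _) (inj₁ (_ , hb≡v)) _ =
    b′ , inj₂ (inj₁ (tb′≡v , hb′≡w)) , trans tb′≡v (sym hb≡v)
  succ-onSeq u (v ∷ ws) b (_ , c) (inj₂ o) hb≢end =
    let b′ , o′ , tb′≡hb = succ-onSeq v ws b c o hb≢end in b′ , inj₂ o′ , tb′≡hb

  pred-onSeq : ∀ u vs b → Chain tl hd u vs → OnSeq tl hd b u vs → tl b ≢ u →
               ∃[ b′ ] (OnSeq tl hd b′ u vs × hd b′ ≡ tl b)
  pred-onSeq u (v ∷ vs) b c (inj₁ (tb≡u , _)) tb≢u = ⊥-elim (tb≢u tb≡u)
  pred-onSeq u (v ∷ vs) b ((b₀ , tb₀≡u , hb₀≡v) , c) (inj₂ o) tb≢u with tl b ≟ v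
  ... | yes tb≡v = b₀ , inj₁ (tb₀≡u , hb₀≡v) , trans hb₀≡v (sym tb≡v)
  ... | no tb≢v  = let b′ , o′ , hb′≡tb = pred-onSeq v vs b c o tb≢v in b′ , inj₂ o′ , hb′≡tb

module _ (D : Network) where
  open Network D

  arcs-acyclic : NoCycle (ArcFromTo tl hd)
  arcs-acyclic u vs c = acyclic u vs (RChain⇒Chain u (vs ++ [ u ]) c)

  chain-unique : ∀ u vs → Chain tl hd u vs → Unique (u ∷ vs)
  chain-unique u vs c = RChain-unique (ArcFromTo tl hd) arcs-acyclic u vs (Chain⇒RChain u vs c)

  onSeq-tl-injective : ∀ u vs b b′ → Unique (u ∷ vs) → OnSeq tl hd b u vs → OnSeq tl hd b′ u vs →
                       tl b ≡ tl b′ → b ≡ b′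
  onSeq-tl-injective u (v ∷ vs) b b′ _ (inj₁ (tb≡u , hb≡v)) (inj₁ (tb′≡u , hb′≡v)) _ =
    simple b b′ (trans tb≡u (sym tb′≡u)) (trans hb≡v (sym hb′≡v))
  onSeq-tl-injective u (v ∷ vs) b b′ (u∉ ∷ _) (inj₁ (tb≡u , _)) (inj₂ o′) tb≡tb′ =
    ⊥-elim (All¬⇒¬Any u∉ (subst (_∈ v ∷ vs) (trans (sym tb≡tb′) tb≡u) (onSeq⇒tl∈ b′ v vs o′)))
  onSeq-tl-injective u (v ∷ vs) b b′ (u∉ ∷ _) (inj₂ o) (inj₁ (tb′≡u , _)) tb≡tb′ =
    ⊥-elim (All¬⇒¬Any u∉ (subst (_∈ v ∷ vs) (trans tb≡tb′ tb′≡u) (onSeq⇒tl∈ b v vs o)))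
  onSeq-tl-injective u (v ∷ vs) b b′ (_ ∷ uvs) (inj₂ o) (inj₂ o′) tb≡tb′ =
    onSeq-tl-injective v vs b b′ uvs o o′ tb≡tb′

  onSeq-hd-injective : ∀ u vs b b′ → Unique (u ∷ vs) → OnSeq tl hd b u vs → OnSeq tl hd b′ u vs →
                       hd b ≡ hd b′ → b ≡ b′
  onSeq-hd-injective u (v ∷ vs) b b′ _ (inj₁ (tb≡u , hb≡v)) (inj₁ (tb′≡u , hb′≡v)) _ =
    simple b b′ (trans tb≡u (sym tb′≡u)) (trans hb≡v (sym hb′≡v))
  onSeq-hd-injective u (v ∷ vs) b b′ (_ ∷ v∉ ∷ _) (inj₁ (_ , hb≡v)) (inj₂ o′) hb≡hb′ =
    ⊥-elim (All¬⇒¬Any v∉ (subst (_∈ vs) (trans (sym hb≡hb′) hb≡v) (onSeq⇒hd∈ b′ v vs o′)))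
  onSeq-hd-injective u (v ∷ vs) b b′ (_ ∷ v∉ ∷ _) (inj₂ o) (inj₁ (_ , hb′≡v)) hb≡hb′ =
    ⊥-elim (All¬⇒¬Any v∉ (subst (_∈ vs) (trans hb≡hb′ hb′≡v) (onSeq⇒hd∈ b v vs o)))
  onSeq-hd-injective u (v ∷ vs) b b′ (_ ∷ uvs) (inj₂ o) (inj₂ o′) hb≡hb′ =
    onSeq-hd-injective v vs b b′ uvs o o′ hb≡hb′

  onSeq⇒tl≢end : ∀ u vs b → Unique (u ∷ vs) → OnSeq tl hd b u vs → tl b ≢ endOf u vs
  onSeq⇒tl≢end u (v ∷ vs) b (u∉ ∷ _) (inj₁ (tb≡u , _)) tb≡end =
    All¬⇒¬Any u∉ (subst (_∈ v ∷ vs) (trans (sym tb≡end) tb≡u) (endOf∈ u v vs))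
  onSeq⇒tl≢end u (v ∷ vs) b (_ ∷ uvs) (inj₂ o) = onSeq⇒tl≢end v vs b uvs o

  onSeq⊆⇒≡ : ∀ u q p → Chain tl hd u q → Unique (u ∷ q) → Unique (u ∷ p) → endOf u q ≡ endOf u p →
             (∀ b → OnSeq tl hd b u q → OnSeq tl hd b u p) → q ≡ p
  onSeq⊆⇒≡ u []      []       _ _ _ _ _ = refl
  onSeq⊆⇒≡ u []      (w ∷ p) _ _ (u∉ ∷ _) u≡end _ =
    ⊥-elim (All¬⇒¬Any u∉ (subst (_∈ w ∷ p) (sym u≡end) (endOf∈ u w p)))
  onSeq⊆⇒≡ u (v ∷ q) []       ((f , tf≡u , hf≡v) , _) _ _ _ ⊆ = ⊥-elim (⊆ f (inj₁ (tf≡u , hf≡v)))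
  onSeq⊆⇒≡ u (v ∷ q) (w ∷ p) ((f , tf≡u , hf≡v) , c) (u∉q ∷ uq) (u∉p ∷ up) end≡ ⊆
    with ⊆ f (inj₁ (tf≡u , hf≡v))
  ... | inj₂ o = ⊥-elim (All¬⇒¬Any u∉p (subst (_∈ w ∷ p) tf≡u (onSeq⇒tl∈ f w p o)))
  ... | inj₁ (_ , hf≡w) with trans (sym hf≡v) hf≡w
  ...   | refl = cong (v ∷_) (onSeq⊆⇒≡ v q p c uq up end≡ ⊆′)
    where
    ⊆′ : ∀ b → OnSeq tl hd b v q → OnSeq tl hd b v p
    ⊆′ b o with ⊆ b (inj₂ o)
    ... | inj₂ o′          = o′
    ... | inj₁ (tb≡u , _) = ⊥-elim (All¬⇒¬Any u∉q (subst (_∈ v ∷ q) tb≡u (onSeq⇒tl∈ b v q o)))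

  stPath-chain : ∀ {p} → IsSTPath D p → Chain tl hd s p
  stPath-chain ((c , _) , _) = c

  stPath-unique : ∀ {p} → IsSTPath D p → Unique (s ∷ p)
  stPath-unique ((_ , u) , _) = u

  stPath-end : ∀ {p} → IsSTPath D p → endOf s p ≡ t
  stPath-end (_ , e) = e

  chain⇒stPath : ∀ p → Chain tl hd s p → endOf s p ≡ t → IsSTPath D p
  chain⇒stPath p c e = (c , chain-unique s p c) , e

  stPath-length : ∀ {p} → IsSTPath D p → length p ℕ.≤ n
  stPath-length h = ℕ.≤-trans (ℕ.n≤1+n _) (unique⇒length≤ _ (stPath-unique h))

  stPath⇒s≢t : ∀ {p b} → IsSTPath D p → OnSeq tl hd b s p → s ≢ t
  stPath⇒s≢t {w ∷ p} h _ s≡t with stPath-unique h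
  ... | s∉ ∷ _ = All¬⇒¬Any s∉ (subst (_∈ w ∷ p) (trans (stPath-end h) (sym s≡t)) (endOf∈ s w p))

  Ã⇒hd≢s : ∀ b → InÃ D b → hd b ≢ s
  Ã⇒hd≢s b (p , h , o) hb≡s with stPath-unique h
  ... | s∉ ∷ _ = All¬⇒¬Any s∉ (subst (_∈ p) hb≡s (onSeq⇒hd∈ b s p o))

  Ã⇒tl≢t : ∀ b → InÃ D b → tl b ≢ t
  Ã⇒tl≢t b (p , h , o) tb≡t = onSeq⇒tl≢end s p b (stPath-unique h) o (trans tb≡t (sym (stPath-end h)))

  ArcsInÃ : Fin n → List (Fin n) → Set
  ArcsInÃ u vs = ∀ b → OnSeq tl hd b u vs → InÃ D b

  stPath-Ã : ∀ {p} → IsSTPath D p → ArcsInÃ s p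
  stPath-Ã {p} h b o = p , h , o

  s∉Ã-chain : ∀ u vs → Chain tl hd u vs → ArcsInÃ u vs → ¬ s ∈ vs
  s∉Ã-chain u vs c ar s∈vs with ∈⇒onSeq-hd u vs s c s∈vs
  ... | b , o , hb≡s = Ã⇒hd≢s b (ar b o) hb≡s

  arc? : ∀ u v → Dec (ArcFromTo tl hd u v)
  arc? u v = Fin.any? (λ b → (tl b ≟ u) ×-dec (hd b ≟ v))

  chain? : ∀ u vs → Dec (Chain tl hd u vs)
  chain? u []       = yes tt
  chain? u (v ∷ vs) = arc? u v ×-dec chain? v vs

  stPath? : ∀ vs → Dec (IsSTPath D vs)
  stPath? vs = (chain? s vs ×-dec UniqueDec.unique? _≟_ (s ∷ vs)) ×-dec (endOf s vs ≟ t)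

  stPath-∃? : (Q : List (Fin n) → Set) → (∀ vs → Dec (Q vs)) → Dec (∃[ p ] (IsSTPath D p × Q p))
  stPath-∃? Q Q? = bounded-∃? n _ (λ vs → stPath? vs ×-dec Q? vs) (λ vs → stPath-length ∘ proj₁)

  InÃ? : ∀ b → Dec (InÃ D b)
  InÃ? b = stPath-∃? (OnSeq tl hd b s) (onSeq? b s)

  inArcÃ? : ∀ u b → Dec (InArcÃ D u b)
  inArcÃ? u b = InÃ? b ×-dec (hd b ≟ u)

  outArcÃ? : ∀ u b → Dec (OutArcÃ D u b)
  outArcÃ? u b = InÃ? b ×-dec (tl b ≟ u)

  ¬two⇒unique : ∀ {P : Fin m → Set} a → P a → ¬ AtLeastTwo D P → ∀ b → P b → b ≡ a
  ¬two⇒unique a pa ¬two b pb with b ≟ a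
  ... | yes b≡a = b≡a
  ... | no b≢a  = ⊥-elim (¬two (b , a , b≢a , pb , pa))

  module Count {P : Fin m → Set} (P? : ∀ b → Dec (P b)) where

    exactlyOne? : Dec (ExactlyOne D P)
    exactlyOne? with Fin.any? P?
    ... | no ∄ = no λ (a , pa , _) → ∄ (a , pa)
    ... | yes (a , pa) with Fin.all? (λ b → P? b →-dec (b ≟ a))
    ...   | yes only = yes (a , pa , only)
    ...   | no ¬only = no λ (a′ , _ , only′) → ¬only λ b pb → trans (only′ b pb) (sym (only′ a pa))

    ¬exactlyOne⇒two : ∀ a → P a → ¬ ExactlyOne D P → AtLeastTwo D P
    ¬exactlyOne⇒two a pa ¬one with Fin.¬∀⟶∃¬ m _ (λ b → P? b →-dec (b ≟ a)) (λ only → ¬one (a , pa , only))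
    ... | b , ¬only with P? b | b ≟ a
    ...   | yes pb | no b≢a  = b , a , b≢a , pb , pa
    ...   | yes pb | yes b≡a = ⊥-elim (¬only λ _ → b≡a)
    ...   | no ¬pb | _       = ⊥-elim (¬only (⊥-elim ∘ ¬pb))

    two? : Dec (AtLeastTwo D P)
    two? with Fin.any? P?
    ... | no ∄ = no λ (a , _ , _ , pa , _) → ∄ (a , pa)
    ... | yes (a , pa) with exactlyOne?
    ...   | no ¬one             = yes (¬exactlyOne⇒two a pa ¬one)
    ...   | yes (_ , _ , only) = no λ (x , y , x≢y , px , py) → x≢y (trans (only x px) (sym (only y py)))

  through? : ∀ u → Dec (Through D u)
  through? u = Count.exactlyOne? (inArcÃ? u) ×-dec Count.exactlyOne? (outArcÃ? u)

  notThrough⇒¬through : ∀ u → NotThrough D u → ¬ Through D u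
  notThrough⇒¬through u (inj₁ ¬in)  (i , _) = ¬in i
  notThrough⇒¬through u (inj₂ ¬out) (_ , o) = ¬out o

  ¬through⇒notThrough : ∀ u → ¬ Through D u → NotThrough D u
  ¬through⇒notThrough u ¬thr with Count.exactlyOne? (inArcÃ? u)
  ... | no ¬in = inj₁ ¬in
  ... | yes i  = inj₂ λ o → ¬thr (i , o)

  s-notThrough : NotThrough D s
  s-notThrough = inj₁ λ (b , (ib , hb≡s) , _) → Ã⇒hd≢s b ib hb≡s

  t-notThrough : NotThrough D t
  t-notThrough = inj₂ λ (b , (ib , tb≡t) , _) → Ã⇒tl≢t b ib tb≡t

  Σ≡sum : ∀ {k} (f : Fin k → ℚ) → Σ[_] D f ≡ sum f
  Σ≡sum {zero}  f = refl
  Σ≡sum {suc k} f = cong (f zero +_) (Σ≡sum (λ i → f (suc i)))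

  netflow : (Fin m → ℚ) → Fin n → ℚ
  netflow x w = outflow D x w - inflow D x w

  netflow≡ : ∀ x w → netflow x w ≡ incident tl x w - incident hd x w
  netflow≡ x w = cong₂ _-_ (Σ≡sum (at tl w x)) (Σ≡sum (at hd w x))

  -- FlowPolytope D is definitionally Flow 1ℚ.
  Flow : ℚ → (Fin m → ℚ) → Set
  Flow v x = (∀ b → 0ℚ ≤ x b) × (∀ w → w ≢ s → w ≢ t → netflow x w ≡ 0ℚ) × netflow x s ≡ v

  netflow-lin : ∀ x y c w → netflow (λ b → x b - c * y b) w ≡ netflow x w - c * netflow y w
  netflow-lin x y c w = begin
    netflow (λ b → x b - c * y b) w
      ≡⟨ netflow≡ _ w ⟩
    incident tl (λ b → x b - c * y b) w - incident hd (λ b → x b - c * y b) w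
      ≡⟨ cong₂ _-_ (incident-lin tl x y c w) (incident-lin hd x y c w) ⟩
    (incident tl x w - c * incident tl y w) - (incident hd x w - c * incident hd y w)
      ≡⟨ solve 5 (λ a b c d e → (a :- c :* b) :- (d :- c :* e) := (a :- d) :- c :* (b :- e)) refl
               (incident tl x w) (incident tl y w) c (incident hd x w) (incident hd y w) ⟩
    (incident tl x w - incident hd x w) - c * (incident tl y w - incident hd y w)
      ≡⟨ sym (cong₂ (λ p q → p - c * q) (netflow≡ x w) (netflow≡ y w)) ⟩
    netflow x w - c * netflow y w ∎
    where open ≡-Reasoning

  netflow-+ : ∀ x y w → netflow (λ b → x b + y b) w ≡ netflow x w + netflow y w
  netflow-+ x y w = begin
    netflow (λ b → x b + y b) w
      ≡⟨ netflow≡ _ w ⟩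
    incident tl (λ b → x b + y b) w - incident hd (λ b → x b + y b) w
      ≡⟨ cong₂ _-_ (incident-+ tl x y w) (incident-+ hd x y w) ⟩
    (incident tl x w + incident tl y w) - (incident hd x w + incident hd y w)
      ≡⟨ solve 4 (λ a b d e → (a :+ b) :- (d :+ e) := (a :- d) :+ (b :- e)) refl
               (incident tl x w) (incident tl y w) (incident hd x w) (incident hd y w) ⟩
    (incident tl x w - incident hd x w) + (incident tl y w - incident hd y w)
      ≡⟨ sym (cong₂ _+_ (netflow≡ x w) (netflow≡ y w)) ⟩
    netflow x w + netflow y w ∎
    where open ≡-Reasoning

  netflow-zero : ∀ x w → (∀ b → x b ≡ 0ℚ) → netflow x w ≡ 0ℚ
  netflow-zero x w x≡0 =
    trans (netflow≡ x w) (trans (cong₂ _-_ (incident-zero tl x w x≡0) (incident-zero hd x w x≡0)) (+-inverseʳ 0ℚ))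

  ∑-netflow : ∀ x → sum (netflow x) ≡ 0ℚ
  ∑-netflow x = begin
    sum (netflow x)                                       ≡⟨ sum-cong-≗ (netflow≡ x) ⟩
    sum (λ w → incident tl x w - incident hd x w)         ≡⟨ ∑-distrib-- (incident tl x) (incident hd x) ⟩
    sum (incident tl x) - sum (incident hd x)             ≡⟨ cong₂ _-_ (∑-incident tl x) (∑-incident hd x) ⟩
    sum x - sum x                                         ≡⟨ +-inverseʳ (sum x) ⟩
    0ℚ                                                    ∎
    where open ≡-Reasoning

  flow-s≡t⇒value≡0 : ∀ {v x} → Flow v x → s ≡ t → v ≡ 0ℚ
  flow-s≡t⇒value≡0 {v} {x} (_ , conserve , net-s≡v) s≡t = begin
    v                ≡⟨ sym net-s≡v ⟩
    netflow x s      ≡⟨ sym (sum-single (netflow x) s (λ w w≢s → conserve w w≢s (w≢s ∘ flip trans (sym s≡t)))) ⟩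
    sum (netflow x)  ≡⟨ ∑-netflow x ⟩
    0ℚ               ∎
    where open ≡-Reasoning

  flow-netflow-t : ∀ {v x} → Flow v x → s ≢ t → netflow x t ≡ - v
  flow-netflow-t {v} {x} (_ , conserve , net-s≡v) s≢t = begin
    netflow x t                               ≡⟨ solve 2 (λ p q → q := (p :+ q) :- p) refl (netflow x s) (netflow x t) ⟩
    (netflow x s + netflow x t) - netflow x s ≡⟨ cong₂ _-_ net-s+net-t≡0 net-s≡v ⟩
    0ℚ - v                                    ≡⟨ +-identityˡ (- v) ⟩
    - v                                       ∎
    where
    open ≡-Reasoning
    net-s+net-t≡0 : netflow x s + netflow x t ≡ 0ℚ
    net-s+net-t≡0 = trans (sym (sum-pair (netflow x) s t s≢t (λ w → conserve w))) (∑-netflow x)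

  PosArc : (Fin m → ℚ) → Fin n → Fin n → Set
  PosArc x u w = ∃[ b ] (tl b ≡ u × hd b ≡ w × 0ℚ < x b)

  posArcs-acyclic : ∀ x → NoCycle (PosArc x)
  posArcs-acyclic x u vs c = arcs-acyclic u vs (RChain-map (λ (b , tb≡u , hb≡w , _) → b , tb≡u , hb≡w) u _ c)

  module PositiveWalks {v x} (flow : Flow v x) (0≤v : 0ℚ ≤ v) where

    private
      0≤x = proj₁ flow
      conserve = proj₁ (proj₂ flow)
      net-s≡v = proj₂ (proj₂ flow)

    out≡in+net : ∀ w → incident tl x w ≡ incident hd x w + netflow x w
    out≡in+net w = trans (solve 2 (λ p q → p := q :+ (p :- q)) refl (incident tl x w) (incident hd x w))
                         (cong (incident hd x w +_) (sym (netflow≡ x w)))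

    0<in⇒0<out : ∀ w → w ≢ t → 0ℚ < incident hd x w → 0ℚ < incident tl x w
    0<in⇒0<out w w≢t 0<in with w ≟ s
    ... | yes refl = <-≤-trans 0<in (subst (incident hd x s ≤_)
                       (sym (trans (out≡in+net s) (cong (incident hd x s +_) net-s≡v))) (p≤p+0≤ 0≤v))
    ... | no w≢s = subst (0ℚ <_) (sym (trans (out≡in+net w) (trans (cong (incident hd x w +_) (conserve w w≢s w≢t))
                                                                (+-identityʳ _)))) 0<in

    walk-to-t : ∀ u → 0ℚ < incident tl x u → ∃[ ws ] (RChain (PosArc x) u ws × endOf u ws ≡ t)
    walk-to-t = walk-to (PosArc x) (posArcs-acyclic x) (_≡ t) (λ u → 0ℚ < incident tl x u) (_≟ t) step
      where
      step : ∀ u → 0ℚ < incident tl x u → u ≢ t → ∃[ w ] (PosArc x u w × (w ≡ t ⊎ 0ℚ < incident tl x w))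
      step u 0<out _ with 0<incident⇒arc tl x u 0≤x 0<out
      ... | b , tb≡u , 0<xb with hd b ≟ t
      ...   | yes hb≡t = hd b , (b , tb≡u , refl , 0<xb) , inj₁ hb≡t
      ...   | no hb≢t  = hd b , (b , tb≡u , refl , 0<xb) ,
                         inj₂ (0<in⇒0<out (hd b) hb≢t (<-≤-trans 0<xb (arc≤incident hd x 0≤x b)))

    out-of-t≡0 : ∀ b → tl b ≡ t → x b ≡ 0ℚ
    out-of-t≡0 b tb≡t with 0≤-cases (0≤x b)
    ... | inj₁ xb≡0 = xb≡0
    ... | inj₂ 0<xb with walk-to-t (hd b) (0<in⇒0<out (hd b) (λ hb≡t → loopless b (trans tb≡t (sym hb≡t)))
                                            (<-≤-trans 0<xb (arc≤incident hd x 0≤x b)))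
    ...   | ws , c , end≡t =
      ⊥-elim (no-return (PosArc x) (posArcs-acyclic x) (hd b) ws (hd b) c
                        (b , trans tb≡t (sym end≡t) , refl , 0<xb) (here refl))

    in-t≡v : incident hd x t ≡ v
    in-t≡v = begin
      incident hd x t                                   ≡⟨ solve 2 (λ p q → q := p :- (p :- q)) refl (incident tl x t) _ ⟩
      incident tl x t - (incident tl x t - incident hd x t) ≡⟨ cong₂ _-_ out-t≡0 (sym (netflow≡ x t)) ⟩
      0ℚ - netflow x t                                   ≡⟨ cong (λ q → 0ℚ - q) net-t≡-v ⟩
      0ℚ - - v                                           ≡⟨ solve 1 (λ v → con 0ℚ :- (:- v) := v) refl v ⟩
      v                                                  ∎
      where
      open ≡-Reasoning
      out-t≡0 : incident tl x t ≡ 0ℚ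
      out-t≡0 = sum-zero _ (λ b → at-zero′ b)
        where
        at-zero′ : ∀ b → at tl t x b ≡ 0ℚ
        at-zero′ b with at-cases tl t x b
        ... | inj₁ (tb≡t , at≡x) = trans at≡x (out-of-t≡0 b tb≡t)
        ... | inj₂ at≡0          = at≡0
      net-t≡-v : netflow x t ≡ - v
      net-t≡-v with s ≟ t
      ... | no s≢t  = flow-netflow-t flow s≢t
      ... | yes s≡t = let v≡0 = flow-s≡t⇒value≡0 flow s≡t in
        trans (subst (λ z → netflow x z ≡ v) s≡t net-s≡v) (trans v≡0 (sym (cong -_ v≡0)))

    walk-from-s : 0ℚ < v → ∃[ ws ] (RChain (PosArc x) s ws × endOf s ws ≡ t)
    walk-from-s 0<v = walk-to-t s (<-≤-trans 0<v (subst (v ≤_)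
      (sym (trans (out≡in+net s) (cong (incident hd x s +_) net-s≡v))) (p≤0≤+p (incident-nonNeg hd x s 0≤x))))

    value≡0⇒flow≡0 : v ≡ 0ℚ → ∀ b → x b ≡ 0ℚ
    value≡0⇒flow≡0 v≡0 b with 0≤-cases (0≤x b)
    ... | inj₁ xb≡0 = xb≡0
    ... | inj₂ 0<xb with walk-to-t (tl b) (<-≤-trans 0<xb (arc≤incident tl x 0≤x b))
    ...   | []     , _ , tb≡t  = ⊥-elim (0<⇒≢0 0<xb (out-of-t≡0 b tb≡t))
    ...   | w ∷ ws , c , end≡t with RChain-last (PosArc x) (tl b) w ws c
    ...     | _ , b′ , _ , hb′≡end , 0<xb′ = ⊥-elim (0<⇒≢0 (<-≤-trans 0<xb′ xb′≤in-t) (trans in-t≡v v≡0))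
      where
      xb′≤in-t : x b′ ≤ incident hd x t
      xb′≤in-t = subst (x b′ ≤_) (cong (incident hd x) (trans hb′≡end end≡t)) (arc≤incident hd x 0≤x b′)

  𝟙ₙ : Fin n → Fin n → ℚ
  𝟙ₙ u w = if does (u ≟ w) then 1ℚ else 0ℚ

  𝟙ₙ-refl : ∀ u → 𝟙ₙ u u ≡ 1ℚ
  𝟙ₙ-refl u with u ≟ u
  ... | yes _  = refl
  ... | no u≢u = ⊥-elim (u≢u refl)

  𝟙ₙ-≢ : ∀ {u w} → u ≢ w → 𝟙ₙ u w ≡ 0ℚ
  𝟙ₙ-≢ {u} {w} u≢w with u ≟ w
  ... | yes u≡w = ⊥-elim (u≢w u≡w)
  ... | no _    = refl

  𝟙ₐ : Fin n → Fin n → Fin m → ℚ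
  𝟙ₐ u v b = if does (tl b ≟ u) ∧ does (hd b ≟ v) then 1ℚ else 0ℚ

  𝟙ₐ-on : ∀ {u v} b → tl b ≡ u → hd b ≡ v → 𝟙ₐ u v b ≡ 1ℚ
  𝟙ₐ-on {u} {v} b tb≡u hb≡v with tl b ≟ u | hd b ≟ v
  ... | yes _    | yes _    = refl
  ... | no tb≢u  | _        = ⊥-elim (tb≢u tb≡u)
  ... | yes _    | no hb≢v  = ⊥-elim (hb≢v hb≡v)

  𝟙ₐ-off : ∀ {u v} b → ¬ (tl b ≡ u × hd b ≡ v) → 𝟙ₐ u v b ≡ 0ℚ
  𝟙ₐ-off {u} {v} b ¬uv with tl b ≟ u | hd b ≟ v
  ... | yes tb≡u | yes hb≡v = ⊥-elim (¬uv (tb≡u , hb≡v))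
  ... | yes _    | no _     = refl
  ... | no _     | _        = refl

  netflow-𝟙ₐ : ∀ {u v} → ArcFromTo tl hd u v → ∀ w → netflow (𝟙ₐ u v) w ≡ 𝟙ₙ u w - 𝟙ₙ v w
  netflow-𝟙ₐ {u} {v} (e , te≡u , he≡v) w =
    trans (netflow≡ _ w) (cong₂ _-_ (incident-𝟙ₐ tl te≡u) (incident-𝟙ₐ hd he≡v))
    where
    only-e : ∀ b → b ≢ e → 𝟙ₐ u v b ≡ 0ℚ
    only-e b b≢e =
      𝟙ₐ-off b λ (tb≡u , hb≡v) → b≢e (simple b e (trans tb≡u (sym te≡u)) (trans hb≡v (sym he≡v)))
    incident-𝟙ₐ : ∀ (end : Fin m → Fin n) {z} → end e ≡ z → incident end (𝟙ₐ u v) w ≡ 𝟙ₙ z w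
    incident-𝟙ₐ end {z} ee≡z = trans (incident-single end (𝟙ₐ u v) w e only-e) at-e
      where
      at-e : at end w (𝟙ₐ u v) e ≡ 𝟙ₙ z w
      at-e with z ≟ w
      ... | yes z≡w = trans (at-on end (𝟙ₐ u v) e (trans ee≡z z≡w)) (𝟙ₐ-on e te≡u he≡v)
      ... | no z≢w  = at-off end (𝟙ₐ u v) e (λ ee≡w → z≢w (trans (sym ee≡z) ee≡w))

  χ : Fin n → List (Fin n) → Fin m → ℚ
  χ u []       b = 0ℚ
  χ u (v ∷ vs) b = 𝟙ₐ u v b + χ v vs b

  netflow-χ : ∀ u vs → Chain tl hd u vs → ∀ w → netflow (χ u vs) w ≡ 𝟙ₙ u w - 𝟙ₙ (endOf u vs) w
  netflow-χ u []       _       w = trans (netflow-zero _ w (λ _ → refl)) (sym (+-inverseʳ (𝟙ₙ u w)))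
  netflow-χ u (v ∷ vs) (r , c) w =
    trans (netflow-+ (𝟙ₐ u v) (χ v vs) w)
      (trans (cong₂ _+_ (netflow-𝟙ₐ r w) (netflow-χ v vs c w))
        (solve 3 (λ a b c → (a :- b) :+ (b :- c) := a :- c) refl (𝟙ₙ u w) (𝟙ₙ v w) (𝟙ₙ (endOf v vs) w)))

  χ-++ : ∀ u xs ys b → χ u (xs ++ ys) b ≡ χ u xs b + χ (endOf u xs) ys b
  χ-++ u []       ys b = sym (+-identityˡ _)
  χ-++ u (x ∷ xs) ys b = trans (cong (𝟙ₐ u x b +_) (χ-++ x xs ys b)) (sym (+-assoc (𝟙ₐ u x b) (χ x xs b) _))

  χ-off : ∀ u vs b → ¬ OnSeq tl hd b u vs → χ u vs b ≡ 0ℚ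
  χ-off u []       b _   = refl
  χ-off u (v ∷ vs) b ¬on =
    trans (cong₂ _+_ (𝟙ₐ-off b (¬on ∘ inj₁)) (χ-off v vs b (¬on ∘ inj₂))) (+-identityʳ 0ℚ)

  χ-on : ∀ u vs b → Unique (u ∷ vs) → OnSeq tl hd b u vs → χ u vs b ≡ 1ℚ
  χ-on u (v ∷ vs) b (u∉ ∷ _) (inj₁ (tb≡u , hb≡v)) =
    trans (cong₂ _+_ (𝟙ₐ-on b tb≡u hb≡v) (χ-off v vs b later-off)) (+-identityʳ 1ℚ)
    where
    later-off : ¬ OnSeq tl hd b v vs
    later-off o = All¬⇒¬Any u∉ (subst (_∈ v ∷ vs) tb≡u (onSeq⇒tl∈ b v vs o))
  χ-on u (v ∷ vs) b (u∉ ∷ uvs) (inj₂ o) =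
    trans (cong₂ _+_ (𝟙ₐ-off b first-off) (χ-on v vs b uvs o)) (+-identityˡ 1ℚ)
    where
    first-off : ¬ (tl b ≡ u × hd b ≡ v)
    first-off (tb≡u , _) = All¬⇒¬Any u∉ (subst (_∈ v ∷ vs) tb≡u (onSeq⇒tl∈ b v vs o))

  χ-nonNeg : ∀ u vs b → Unique (u ∷ vs) → 0ℚ ≤ χ u vs b
  χ-nonNeg u vs b uvs with onSeq? b u vs
  ... | yes o  = subst (0ℚ ≤_) (sym (χ-on u vs b uvs o)) (<⇒≤ 0<1)
  ... | no ¬o = ≤-reflexive (sym (χ-off u vs b ¬o))

  stPath-flow : ∀ {p} → IsSTPath D p → s ≢ t → Flow 1ℚ (χ s p)
  stPath-flow {p} h s≢t = (λ b → χ-nonNeg s p b (stPath-unique h)) , conserve , net-s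
    where
    net≡ : ∀ w → netflow (χ s p) w ≡ 𝟙ₙ s w - 𝟙ₙ t w
    net≡ w = trans (netflow-χ s p (stPath-chain h) w) (cong (λ z → 𝟙ₙ s w - 𝟙ₙ z w) (stPath-end h))
    conserve : ∀ w → w ≢ s → w ≢ t → netflow (χ s p) w ≡ 0ℚ
    conserve w w≢s w≢t = trans (net≡ w) (cong₂ _-_ (𝟙ₙ-≢ (w≢s ∘ sym)) (𝟙ₙ-≢ (w≢t ∘ sym)))
    net-s : netflow (χ s p) s ≡ 1ℚ
    net-s = trans (net≡ s) (cong₂ _-_ (𝟙ₙ-refl s) (𝟙ₙ-≢ (s≢t ∘ sym)))

  record Peeling (v : ℚ) (x : Fin m → ℚ) : Set where
    field
      path      : List (Fin n)
      isSTPath  : IsSTPath D path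
      weight    : ℚ
      0<weight  : 0ℚ < weight
      weight≤v  : weight ≤ v
      rest      : Fin m → ℚ
      rest-flow : Flow (v - weight) rest
      split     : ∀ b → x b ≡ weight * χ s path b + rest b
      zeros     : ∀ b → x b ≡ 0ℚ → rest b ≡ 0ℚ
      new-zero  : ∃[ b ] (x b ≢ 0ℚ × rest b ≡ 0ℚ)

  module _ {x : Fin m → ℚ} where

    bottleneck : ∀ u w ws → RChain (PosArc x) u (w ∷ ws) → ℚ
    bottleneck u w []        ((b , _) , _) = x b
    bottleneck u w (w′ ∷ ws) ((b , _) , c) = x b ⊓ bottleneck w w′ ws c

    0<bottleneck : ∀ u w ws c → 0ℚ < bottleneck u w ws c
    0<bottleneck u w []        ((_ , _ , _ , 0<xb) , _) = 0<xb
    0<bottleneck u w (w′ ∷ ws) ((b , _ , _ , 0<xb) , c) with ⊓-sel (x b) (bottleneck w w′ ws c)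
    ... | inj₁ ⊓≡xb = subst (0ℚ <_) (sym ⊓≡xb) 0<xb
    ... | inj₂ ⊓≡bn = subst (0ℚ <_) (sym ⊓≡bn) (0<bottleneck w w′ ws c)

    bottleneck≤ : ∀ u w ws c b′ → OnSeq tl hd b′ u (w ∷ ws) → bottleneck u w ws c ≤ x b′
    bottleneck≤ u w []        ((b , tb≡u , hb≡w , _) , _) b′ (inj₁ (tb′≡u , hb′≡w)) =
      ≤-reflexive (cong x (simple b b′ (trans tb≡u (sym tb′≡u)) (trans hb≡w (sym hb′≡w))))
    bottleneck≤ u w (w′ ∷ ws) ((b , tb≡u , hb≡w , _) , c) b′ (inj₁ (tb′≡u , hb′≡w)) =
      ≤-trans (p⊓q≤p (x b) _)
              (≤-reflexive (cong x (simple b b′ (trans tb≡u (sym tb′≡u)) (trans hb≡w (sym hb′≡w)))))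
    bottleneck≤ u w (w′ ∷ ws) ((b , _) , c) b′ (inj₂ o) =
      ≤-trans (p⊓q≤q (x b) _) (bottleneck≤ w w′ ws c b′ o)

    bottleneck-attained : ∀ u w ws c → ∃[ b′ ] (OnSeq tl hd b′ u (w ∷ ws) × x b′ ≡ bottleneck u w ws c)
    bottleneck-attained u w []        ((b , tb≡u , hb≡w , _) , _) = b , inj₁ (tb≡u , hb≡w) , refl
    bottleneck-attained u w (w′ ∷ ws) ((b , tb≡u , hb≡w , _) , c) with ⊓-sel (x b) (bottleneck w w′ ws c)
    ... | inj₁ ⊓≡xb = b , inj₁ (tb≡u , hb≡w) , sym ⊓≡xb
    ... | inj₂ ⊓≡bn =
      let b′ , o , xb′≡bn = bottleneck-attained w w′ ws c in b′ , inj₂ o , trans xb′≡bn (sym ⊓≡bn)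

  peel : ∀ {v x} → Flow v x → 0ℚ < v → Peeling v x
  peel {v} {x} flow 0<v = peel-walk (walk-from-s 0<v)
    where
    open PositiveWalks flow (<⇒≤ 0<v)
    peel-walk : ∃[ ws ] (RChain (PosArc x) s ws × endOf s ws ≡ t) → Peeling v x
    peel-walk ([] , _ , s≡t) = ⊥-elim (0<⇒≢0 0<v (flow-s≡t⇒value≡0 flow s≡t))
    peel-walk (w ∷ ws , c , end≡t) = record
      { path      = p
      ; isSTPath  = (chain , unique) , end≡t
      ; weight    = μ
      ; 0<weight  = 0<bottleneck s w ws c
      ; weight≤v  = μ≤v
      ; rest      = x′
      ; rest-flow = 0≤x′ , conserve′ , net-s′
      ; split     = λ b → solve 3 (λ a l c → a := l :* c :+ (a :- l :* c)) refl (x b) μ (χ s p b)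
      ; zeros     = zeros
      ; new-zero  = new-zero
      }
      where
      p = w ∷ ws
      μ = bottleneck s w ws c
      chain : Chain tl hd s p
      chain = RChain⇒Chain s p (RChain-map (λ (b , tb≡u , hb≡w , _) → b , tb≡u , hb≡w) s p c)
      unique : Unique (s ∷ p)
      unique = RChain-unique (PosArc x) (posArcs-acyclic x) s p c
      s≢t : s ≢ t
      s≢t s≡t = 0<⇒≢0 0<v (flow-s≡t⇒value≡0 flow s≡t)
      x′ : Fin m → ℚ
      x′ b = x b - μ * χ s p b

      μ≤v : μ ≤ v
      μ≤v with last-onSeq s w ws chain
      ... | b , o , hb≡end = ≤-trans (bottleneck≤ s w ws c b o)
        (subst (x b ≤_) (trans (cong (incident hd x) (trans hb≡end end≡t)) in-t≡v)
               (arc≤incident hd x (proj₁ flow) b))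

      x′-on : ∀ b → OnSeq tl hd b s p → x′ b ≡ x b - μ
      x′-on b o = cong (λ q → x b - q) (trans (cong (μ *_) (χ-on s p b unique o)) (*-identityʳ μ))

      x′-off : ∀ b → ¬ OnSeq tl hd b s p → x′ b ≡ x b
      x′-off b ¬o = trans (cong (λ q → x b - μ * q) (χ-off s p b ¬o))
                          (trans (cong (λ q → x b - q) (*-zeroʳ μ)) (+-identityʳ (x b)))

      0≤x′ : ∀ b → 0ℚ ≤ x′ b
      0≤x′ b with onSeq? b s p
      ... | yes o  = subst (0ℚ ≤_) (sym (x′-on b o)) (≤⇒0≤- (bottleneck≤ s w ws c b o))
      ... | no ¬o = subst (0ℚ ≤_) (sym (x′-off b ¬o)) (proj₁ flow b)

      net′ : ∀ u → netflow x′ u ≡ netflow x u - μ * (𝟙ₙ s u - 𝟙ₙ t u)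
      net′ u = trans (netflow-lin x (χ s p) μ u)
        (cong (λ q → netflow x u - μ * q) (trans (netflow-χ s p chain u) (cong (λ z → 𝟙ₙ s u - 𝟙ₙ z u) end≡t)))

      conserve′ : ∀ u → u ≢ s → u ≢ t → netflow x′ u ≡ 0ℚ
      conserve′ u u≢s u≢t = trans (net′ u)
        (trans (cong₂ (λ a q → a - μ * q) (proj₁ (proj₂ flow) u u≢s u≢t)
                      (cong₂ _-_ (𝟙ₙ-≢ (u≢s ∘ sym)) (𝟙ₙ-≢ (u≢t ∘ sym))))
               (trans (cong (λ q → 0ℚ - μ * q) (+-inverseʳ 0ℚ)) (cong (0ℚ +_) (cong -_ (*-zeroʳ μ)))))

      net-s′ : netflow x′ s ≡ v - μ
      net-s′ = trans (net′ s)
        (trans (cong₂ (λ a q → a - μ * q) (proj₂ (proj₂ flow)) (cong₂ _-_ (𝟙ₙ-refl s) (𝟙ₙ-≢ (s≢t ∘ sym))))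
               (cong (λ q → v - q) (*-identityʳ μ)))

      zeros : ∀ b → x b ≡ 0ℚ → x′ b ≡ 0ℚ
      zeros b xb≡0 with onSeq? b s p
      ... | yes o  = ⊥-elim (0<⇒≢0 (<-≤-trans (0<bottleneck s w ws c) (bottleneck≤ s w ws c b o)) xb≡0)
      ... | no ¬o = trans (x′-off b ¬o) xb≡0

      new-zero : ∃[ b ] (x b ≢ 0ℚ × x′ b ≡ 0ℚ)
      new-zero with bottleneck-attained s w ws c
      ... | b , o , xb≡μ = b , (λ xb≡0 → 0<⇒≢0 (0<bottleneck s w ws c) (trans (sym xb≡μ) xb≡0)) ,
                           trans (x′-on b o) (trans (cong (_- μ) xb≡μ) (+-inverseʳ μ))

  record Decomposition (v : ℚ) (x : Fin m → ℚ) : Set where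
    field
      terms     : List (ℚ × List (Fin n))
      0<weights : ∀ {μ p} → (μ , p) ∈ terms → 0ℚ < μ
      paths     : ∀ {μ p} → (μ , p) ∈ terms → IsSTPath D p
      total     : totalWeight terms ≡ v
      coords    : ∀ b → x b ≡ weighted (λ p → χ s p b) terms

  private
    zero-decomposition : ∀ {v x} → Flow v x → (∀ b → x b ≡ 0ℚ) → Decomposition v x
    zero-decomposition {v} {x} flow x≡0 = record
      { terms = [] ; 0<weights = λ () ; paths = λ () ; coords = x≡0
      ; total = trans (sym (netflow-zero x s x≡0)) (proj₂ (proj₂ flow)) }

    add-peeled : ∀ {v x} (pr : Peeling v x) →
                 Decomposition (v - Peeling.weight pr) (Peeling.rest pr) → Decomposition v x
    add-peeled {v} {x} pr dec = record
      { terms     = (weight , path) ∷ terms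
      ; 0<weights = λ { (here refl) → 0<weight ; (there t∈) → 0<weights t∈ }
      ; paths     = λ { (here refl) → isSTPath ; (there t∈) → paths t∈ }
      ; total     = trans (cong (weight +_) total) (solve 2 (λ w v → w :+ (v :- w) := v) refl weight v)
      ; coords    = λ b → trans (split b) (cong (weight * χ s path b +_) (coords b))
      }
      where
      open Peeling pr
      open Decomposition dec

    0<value : ∀ {v x} → Flow v x → 0ℚ ≤ v → ∀ b → x b ≢ 0ℚ → 0ℚ < v
    0<value {v} {x} flow 0≤v b xb≢0 with 0≤-cases 0≤v
    ... | inj₂ 0<v = 0<v
    ... | inj₁ v≡0 = ⊥-elim (xb≢0 (PositiveWalks.value≡0⇒flow≡0 flow 0≤v v≡0 b))

  -- Induction on the number of nonzero arcs, which each peeling decreases.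
  decompose : ∀ fuel {v x} → Flow v x → 0ℚ ≤ v → ∣supp∣ x ℕ.≤ fuel → Decomposition v x
  decompose-peeled : ∀ fuel {v x} → Peeling v x → ∣supp∣ x ℕ.≤ fuel → Decomposition v x

  decompose fuel {v} {x} flow 0≤v bound with Fin.all? (λ b → x b ℚ.≟ 0ℚ)
  ... | yes x≡0 = zero-decomposition flow x≡0
  ... | no x≢0 with Fin.¬∀⟶∃¬ m _ (λ b → x b ℚ.≟ 0ℚ) x≢0
  ...   | b , xb≢0 = decompose-peeled fuel (peel flow (0<value flow 0≤v b xb≢0)) bound

  decompose-peeled fuel {v} {x} pr bound with Peeling.new-zero pr
  ... | b , xb≢0 , restb≡0 with ∣supp∣-shrink x (Peeling.rest pr) (Peeling.zeros pr) b xb≢0 restb≡0 | fuel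
  ...   | shrinks | zero     = ⊥-elim (ℕ.n≮0 (ℕ.<-≤-trans shrinks bound))
  ...   | shrinks | suc fuel′ = add-peeled pr
    (decompose fuel′ (Peeling.rest-flow pr) (≤⇒0≤- (Peeling.weight≤v pr)) (ℕ.≤-pred (ℕ.≤-trans shrinks bound)))

  flow-decomposition : ∀ {x} → FlowPolytope D x → Decomposition 1ℚ x
  flow-decomposition {x} x∈P = decompose (∣supp∣ x) x∈P (<⇒≤ 0<1) ℕ.≤-refl

  module _ {x : Fin m → ℚ} (x∈P : FlowPolytope D x) where
    open Decomposition (flow-decomposition x∈P)

    private
      χ-terms-nonNeg : ∀ b → NonNegTerms (λ p → χ s p b) terms
      χ-terms-nonNeg b t∈ = 0≤* (<⇒≤ (0<weights t∈)) (χ-nonNeg s _ b (stPath-unique (paths t∈)))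

    term⇒0<coord : ∀ {μ p b} → (μ , p) ∈ terms → OnSeq tl hd b s p → 0ℚ < x b
    term⇒0<coord {μ} {p} {b} t∈ o = <-≤-trans 0<μχ (subst (μ * χ s p b ≤_) (sym (coords b))
                                                      (term≤weighted _ terms (χ-terms-nonNeg b) t∈))
      where
      0<μχ : 0ℚ < μ * χ s p b
      0<μχ = subst (0ℚ <_) (sym (trans (cong (μ *_) (χ-on s p b (stPath-unique (paths t∈)) o)) (*-identityʳ μ)))
                   (0<weights t∈)

    0<coord⇒term : ∀ {b} → 0ℚ < x b → ∃₂ λ μ p → (μ , p) ∈ terms × OnSeq tl hd b s p
    0<coord⇒term {b} 0<xb with 0<weighted⇒term _ terms (χ-terms-nonNeg b) (subst (0ℚ <_) (coords b) 0<xb)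
    ... | μ , p , t∈ , 0<μχ with onSeq? b s p
    ...   | yes o  = μ , p , t∈ , o
    ...   | no ¬o = ⊥-elim (0<⇒≢0 0<μχ (trans (cong (μ *_) (χ-off s p b ¬o)) (*-zeroʳ μ)))

    dot-decomposition : ∀ c → dot c x ≡ weighted (λ p → dot c (χ s p)) terms
    dot-decomposition c = trans (dot-cong c coords) (dot-weighted c (χ s) terms)

    zero-propagates : ∀ a b → (∀ p → IsSTPath D p → OnSeq tl hd b s p → OnSeq tl hd a s p) →
                      x a ≡ 0ℚ → x b ≡ 0ℚ
    zero-propagates a b b⇒a xa≡0 with 0≤-cases (proj₁ x∈P b)
    ... | inj₁ xb≡0 = xb≡0
    ... | inj₂ 0<xb =
      let _ , p , t∈ , o = 0<coord⇒term 0<xb in ⊥-elim (0<⇒≢0 (term⇒0<coord t∈ (b⇒a p (paths t∈) o)) xa≡0)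

    constant-on-paths : ∀ c δ → (∀ p → IsSTPath D p → dot c (χ s p) ≡ δ) → dot c x ≡ δ
    constant-on-paths c δ on-paths = begin
      dot c x                                    ≡⟨ dot-decomposition c ⟩
      weighted (λ p → dot c (χ s p)) terms       ≡⟨ weighted-cong _ _ terms (λ t∈ → on-paths _ (paths t∈)) ⟩
      weighted (λ _ → δ) terms                   ≡⟨ weighted-const δ terms ⟩
      totalWeight terms * δ                      ≡⟨ cong (_* δ) total ⟩
      1ℚ * δ                                     ≡⟨ *-identityˡ δ ⟩
      δ                                          ∎
      where open ≡-Reasoning

    coord-constant-on-paths : ∀ a δ → (∀ p → IsSTPath D p → χ s p a ≡ δ) → x a ≡ δ
    coord-constant-on-paths a δ on-paths = begin
      x a                        ≡⟨ sym (*-identityˡ (x a)) ⟩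
      1ℚ * x a                   ≡⟨ sym (dot-scaledUnit 1ℚ a x) ⟩
      dot (scaledUnit 1ℚ a) x    ≡⟨ constant-on-paths (scaledUnit 1ℚ a) δ on-paths′ ⟩
      δ                          ∎
      where
      open ≡-Reasoning
      on-paths′ : ∀ p → IsSTPath D p → dot (scaledUnit 1ℚ a) (χ s p) ≡ δ
      on-paths′ p h = trans (dot-scaledUnit 1ℚ a (χ s p)) (trans (*-identityˡ _) (on-paths p h))

    tight-path : ∀ c δ → (∀ y → FlowPolytope D y → dot c y ≤ δ) → dot c x ≡ δ → ∀ b → 0ℚ < x b →
                 ∃[ p ] (IsSTPath D p × OnSeq tl hd b s p × dot c (χ s p) ≡ δ)
    tight-path c δ valid cx≡δ b 0<xb =
      let _ , p , t∈ , o = 0<coord⇒term 0<xb in p , paths t∈ , o , all-tight t∈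
      where
      s≢t : s ≢ t
      s≢t s≡t = 0<⇒≢0 0<1 (flow-s≡t⇒value≡0 x∈P s≡t)
      all-tight : ∀ {μ p} → (μ , p) ∈ terms → dot c (χ s p) ≡ δ
      all-tight = weighted≡bound⇒terms≡bound (λ p → dot c (χ s p)) δ terms 0<weights total
                    (λ t∈ → valid _ (stPath-flow (paths t∈) s≢t)) (trans (sym (dot-decomposition c)) cx≡δ)

  nonnegFace-isFace : ∀ b → IsFace (FlowPolytope D) (NonnegFace D b)
  nonnegFace-isFace b = inj₂ (scaledUnit (- 1ℚ) b , 0ℚ , (b , -1≢0) , valid , defines)
    where
    -1≢0 : scaledUnit (- 1ℚ) b b ≢ 0ℚ
    -1≢0 with b ≟ b
    ... | yes _  = λ ()
    ... | no b≢b = ⊥-elim (b≢b refl)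
    dot≡-xb : ∀ x → dot (scaledUnit (- 1ℚ) b) x ≡ - x b
    dot≡-xb x = trans (dot-scaledUnit (- 1ℚ) b x) (-1*x≈-x (x b))
    valid : ∀ x → FlowPolytope D x → dot (scaledUnit (- 1ℚ) b) x ≤ 0ℚ
    valid x x∈P = subst (_≤ 0ℚ) (sym (dot≡-xb x)) (neg-antimono-≤ (proj₁ x∈P b))
    defines : NonnegFace D b ≐ (λ x → FlowPolytope D x × dot (scaledUnit (- 1ℚ) b) x ≡ 0ℚ)
    defines x = mk⇔ (λ (x∈P , xb≡0) → x∈P , trans (dot≡-xb x) (cong -_ xb≡0))
                    (λ (x∈P , dot≡0) → x∈P , neg-injective (trans (sym (dot≡-xb x)) dot≡0))

  path⇒nonnegFace≢P : ∀ {p b} → IsSTPath D p → OnSeq tl hd b s p → ¬ (NonnegFace D b ≐ FlowPolytope D)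
  path⇒nonnegFace≢P {p} {b} h o F≐P =
    1≢0 (trans (sym (χ-on s p b (stPath-unique h) o))
               (proj₂ (Equivalence.from (F≐P (χ s p)) (stPath-flow h (stPath⇒s≢t h o)))))

  ÃWalk : Fin n → List (Fin n) → Set
  ÃWalk u ws = Chain tl hd u ws × ArcsInÃ u ws × NotThrough D (endOf u ws)

  stPath-ÃWalk : ∀ {p} → IsSTPath D p → ÃWalk s p
  stPath-ÃWalk h = stPath-chain h , stPath-Ã h , subst (NotThrough D) (sym (stPath-end h)) t-notThrough

  ÃWalk-++ˡ : ∀ u xs ys → ÃWalk u (xs ++ ys) → Chain tl hd u xs × ArcsInÃ u xs
  ÃWalk-++ˡ u xs ys (c , ar , _) = chain-++ˡ u xs ys c , λ b o → ar b (onSeq-++⁺ˡ b u xs ys o)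

  ÃWalk-++ʳ : ∀ u xs ys → ÃWalk u (xs ++ ys) → ÃWalk (endOf u xs) ys
  ÃWalk-++ʳ u xs ys (c , ar , nt) =
    chain-++ʳ u xs ys c , (λ b o → ar b (onSeq-++⁺ʳ b u xs ys o)) , subst (NotThrough D) (endOf-++ u xs ys) nt

  through-in-unique : ∀ {w b b′} → Through D w → InArcÃ D w b → InArcÃ D w b′ → b ≡ b′
  through-in-unique ((_ , _ , only) , _) ib ib′ = trans (only _ ib) (sym (only _ ib′))

  through-out-unique : ∀ {w b b′} → Through D w → OutArcÃ D w b → OutArcÃ D w b′ → b ≡ b′
  through-out-unique (_ , (_ , _ , only)) ob ob′ = trans (only _ ob) (sym (only _ ob′))

  through-successor : ∀ {v w w′ e e′} → Through D v → InÃ D e → tl e ≡ v → hd e ≡ w →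
                      InÃ D e′ → tl e′ ≡ v → hd e′ ≡ w′ → w′ ≡ w
  through-successor thr ie te≡v he≡w ie′ te′≡v he′≡w′ =
    trans (sym he′≡w′) (trans (cong hd (through-out-unique thr (ie′ , te′≡v) (ie , te≡v))) he≡w)

  CorridorPath : Fin n → Fin n → List (Fin n) → Set
  CorridorPath u v vs = Chain tl hd u (v ∷ vs) × ArcsInÃ u (v ∷ vs) × InnerThrough D (v ∷ vs)

  corridorPath-tail : ∀ {u v w vs} → CorridorPath u v (w ∷ vs) → CorridorPath v w vs
  corridorPath-tail ((_ , c) , ar , (_ , it)) = c , (λ b o → ar b (inj₂ o)) , it

  -- Walking back along the corridor is forced, since each inner node has a single in-arc in Ã.
  enters-corridor : ∀ {u v vs a} → CorridorPath u v vs → OnSeq tl hd a u (v ∷ vs) →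
                    ∀ {z ws} → Chain tl hd z ws → ArcsInÃ z ws → OnSeq tl hd a z ws →
                    (∃[ b ] (tl b ≡ u × hd b ≡ v × OnSeq tl hd b z ws)) ⊎ z ∈ v ∷ vs
  enters-corridor {a = a} _ (inj₁ (ta≡u , ha≡v)) _ _ oa = inj₁ (a , ta≡u , ha≡v , oa)
  enters-corridor {u} {v} {w ∷ vs} cor@(((e , te≡u , he≡v) , _) , ar , (thr-v , _)) (inj₂ o) {z} {ws} cz az oa
    with enters-corridor (corridorPath-tail cor) o cz az oa
  ... | inj₂ z∈ = inj₂ (there z∈)
  ... | inj₁ (b , tb≡v , _ , ob) with z ≟ v
  ...   | yes z≡v = inj₂ (here z≡v)
  ...   | no z≢v with pred-onSeq z ws b cz ob (λ tb≡z → z≢v (trans (sym tb≡z) tb≡v))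
  ...     | b′ , ob′ , hb′≡tb =
    let b′≡e = through-in-unique thr-v (az b′ ob′ , trans hb′≡tb tb≡v) (ar e (inj₁ (te≡u , he≡v)) , he≡v)
    in inj₁ (b′ , trans (cong tl b′≡e) te≡u , trans hb′≡tb tb≡v , ob′)

  follows-corridor : ∀ {u v vs} → CorridorPath u v vs → ∀ r → ÃWalk u (v ∷ r) →
                     ∃[ r′ ] (v ∷ r ≡ (v ∷ vs) ++ r′)
  follows-corridor {vs = []} _ r _ = r , refl
  follows-corridor {vs = w ∷ vs} (_ , _ , (thr-v , _)) [] (_ , _ , nt) = ⊥-elim (notThrough⇒¬through _ nt thr-v)
  follows-corridor {u} {v} {w ∷ vs} cor@((_ , (e₂ , te₂≡v , he₂≡w) , _) , ar , (thr-v , _))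
                   (w′ ∷ r) ((_ , (e₁ , te₁≡v , he₁≡w′) , cr) , ar′ , nt)
    with through-successor thr-v (ar e₂ (inj₂ (inj₁ (te₂≡v , he₂≡w)))) te₂≡v he₂≡w
                                 (ar′ e₁ (inj₂ (inj₁ (te₁≡v , he₁≡w′)))) te₁≡v he₁≡w′
  ... | refl with follows-corridor (corridorPath-tail cor) r
                    (((e₁ , te₁≡v , he₁≡w′) , cr) , (λ b o → ar′ b (inj₂ o)) , nt)
  ...   | r′ , eq = r′ , cong (v ∷_) eq

  traverses-corridor : ∀ {u v vs a} → CorridorPath u v vs → OnSeq tl hd a u (v ∷ vs) →
                       ∀ {z ws} → ÃWalk z ws → ¬ z ∈ v ∷ vs → OnSeq tl hd a z ws →
                       ∃₂ λ q r → ws ≡ q ++ (v ∷ vs) ++ r × endOf z q ≡ u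
  traverses-corridor {u} {v} {vs} cor oa {z} {ws} walk@(cz , az , _) z∉ oaz with enters-corridor cor oa cz az oaz
  ... | inj₂ z∈ = ⊥-elim (z∉ z∈)
  ... | inj₁ (b , tb≡u , hb≡v , ob) with onSeq-split b z ws ob
  ...   | q , r , refl , end-q≡tb with hb≡v | tb≡u
  ...     | refl | refl with follows-corridor cor r
                                (subst (λ y → ÃWalk y (hd b ∷ r)) end-q≡tb (ÃWalk-++ʳ z q (hd b ∷ r) walk))
  ...       | r′ , eq = q , r′ , cong (q ++_) eq , end-q≡tb

  corridor-onSeq : ∀ z q vs r {u b} → endOf z q ≡ u → OnSeq tl hd b u vs → OnSeq tl hd b z (q ++ vs ++ r)
  corridor-onSeq z q vs r {b = b} refl o = onSeq-++⁺ʳ b z q (vs ++ r) (onSeq-++⁺ˡ b (endOf z q) vs r o)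

  stPath-traverses : ∀ {u v vs a} → CorridorPath u v vs → OnSeq tl hd a u (v ∷ vs) →
                     ∀ {p} → IsSTPath D p → OnSeq tl hd a s p →
                     ∃₂ λ q r → p ≡ q ++ (v ∷ vs) ++ r × endOf s q ≡ u
  stPath-traverses cor@(c , ar , _) oa h oap = traverses-corridor cor oa (stPath-ÃWalk h) (s∉Ã-chain _ _ c ar) oap

  corridor-arcs-together : ∀ {u v vs b b′} → CorridorPath u v vs →
                           OnSeq tl hd b u (v ∷ vs) → OnSeq tl hd b′ u (v ∷ vs) →
                           ∀ {p} → IsSTPath D p → OnSeq tl hd b s p → OnSeq tl hd b′ s p
  corridor-arcs-together {v = v} {vs} cor ob ob′ {p} h obp with stPath-traverses cor ob h obp
  ... | q , r , refl , end≡u = corridor-onSeq s q (v ∷ vs) r end≡u ob′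

  private
    all-through⇒inner : ∀ ins w → All (Through D) ins → InnerThrough D (ins ++ [ w ])
    all-through⇒inner []          w []              = tt
    all-through⇒inner (x ∷ [])    w (thr ∷ [])      = thr , tt
    all-through⇒inner (x ∷ y ∷ ins) w (thr ∷ thrs) = thr , all-through⇒inner (y ∷ ins) w thrs

    first-notThrough : ∀ x ws → NotThrough D (endOf x ws) →
                       ∃[ ins ] ∃[ w ] ∃[ rest ]
                         (x ∷ ws ≡ ins ++ w ∷ rest × All (Through D) ins × NotThrough D w)
    first-notThrough x ws nt with through? x
    ... | no ¬thr = [] , x , ws , refl , [] , ¬through⇒notThrough x ¬thr
    first-notThrough x []       nt | yes thr = ⊥-elim (notThrough⇒¬through x nt thr)
    first-notThrough x (y ∷ ws) nt | yes thr with first-notThrough y ws nt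
    ... | ins , w , rest , eq , thrs , ntw = x ∷ ins , w , rest , cong (x ∷_) eq , thr ∷ thrs , ntw

  -- Cutting an Ã-walk between non-Through nodes at its non-Through nodes yields corridors.
  walk⇒corridor : ∀ fuel u ws → length ws ℕ.≤ fuel → NotThrough D u → ÃWalk u ws →
                  ∀ {a} → OnSeq tl hd a u ws →
                  ∃[ u′ ] ∃[ vs ] (IsCorridor D u′ vs × OnSeq tl hd a u′ vs)
  walk⇒corridor zero       u (x ∷ ws) () _ _ _
  walk⇒corridor (suc fuel) u (x ∷ ws) len ntu walk {a} o with first-notThrough x ws (proj₂ (proj₂ walk))
  ... | ins , w , rest , eq , thrs , ntw =
    from-split (subst (ÃWalk u) split≡ walk) (onSeq-++⁻ a u seg rest (subst (OnSeq tl hd a u) split≡ o))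
    where
    seg = ins ++ [ w ]
    split≡ : x ∷ ws ≡ seg ++ rest
    split≡ = trans eq (sym (List.++-assoc ins [ w ] rest))
    end-seg : endOf u seg ≡ w
    end-seg = endOf-∷ʳ u ins w
    from-split : ÃWalk u (seg ++ rest) → OnSeq tl hd a u seg ⊎ OnSeq tl hd a (endOf u seg) rest →
                 ∃[ u′ ] ∃[ vs ] (IsCorridor D u′ vs × OnSeq tl hd a u′ vs)
    from-split walk′ (inj₁ o-seg) =
      let c-seg , ar-seg = ÃWalk-++ˡ u seg rest walk′
      in u , seg , ((c-seg , chain-unique u seg c-seg) , ar-seg , all-through⇒inner ins w thrs , ntu ,
                    subst (NotThrough D) (sym end-seg) ntw) , o-seg
    from-split walk′ (inj₂ o-rest) =
      walk⇒corridor fuel w rest len-rest ntw (subst (λ y → ÃWalk y rest) end-seg (ÃWalk-++ʳ u seg rest walk′))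
                    (subst (λ y → OnSeq tl hd a y rest) end-seg o-rest)
      where
      len-rest : length rest ℕ.≤ fuel
      len-rest = ℕ.≤-pred (ℕ.≤-trans (ℕ.≤-trans (ℕ.m≤n+m (suc (length rest)) (length ins))
                   (ℕ.≤-reflexive (trans (sym (List.length-++ ins)) (cong length (sym eq))))) len)

  Ã⇒on-corridor : ∀ {a} → InÃ D a → ∃[ u ] ∃[ vs ] (IsCorridor D u vs × OnSeq tl hd a u vs)
  Ã⇒on-corridor (p , h , o) = walk⇒corridor n s p (stPath-length h) s-notThrough (stPath-ÃWalk h) o

  module CorridorParts {u v vs} (corridor : IsCorridor D u (v ∷ vs)) where

    end : Fin n
    end = endOf v vs

    chain : Chain tl hd u (v ∷ vs)
    chain = proj₁ (proj₁ corridor)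

    arcs : ArcsInÃ u (v ∷ vs)
    arcs = proj₁ (proj₂ corridor)

    cor : CorridorPath u v vs
    cor = chain , arcs , proj₁ (proj₂ (proj₂ corridor))

    notThrough-start : NotThrough D u
    notThrough-start = proj₁ (proj₂ (proj₂ (proj₂ corridor)))

    notThrough-end : NotThrough D end
    notThrough-end = proj₂ (proj₂ (proj₂ (proj₂ corridor)))

    e₁ : Fin m
    e₁ = proj₁ (proj₁ chain)

    te₁≡u : tl e₁ ≡ u
    te₁≡u = proj₁ (proj₂ (proj₁ chain))

    he₁≡v : hd e₁ ≡ v
    he₁≡v = proj₂ (proj₂ (proj₁ chain))

    oe₁ : OnSeq tl hd e₁ u (v ∷ vs)
    oe₁ = inj₁ (te₁≡u , he₁≡v)

    eₗ : Fin m
    eₗ = proj₁ (last-onSeq u v vs chain)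

    oeₗ : OnSeq tl hd eₗ u (v ∷ vs)
    oeₗ = proj₁ (proj₂ (last-onSeq u v vs chain))

    heₗ≡end : hd eₗ ≡ end
    heₗ≡end = proj₂ (proj₂ (last-onSeq u v vs chain))

  module FacetFacts {a : Fin m} (facet : IsFacet (FlowPolytope D) (NonnegFace D a)) where

    -- Maximality makes the two faces equal, and χ(p) lies in {x b = 0}.
    avoids-b⇒avoids-a : ∀ {b q} → IsSTPath D q → OnSeq tl hd b s q → NonnegFace D a ⊆ NonnegFace D b →
                        ∀ {p} → IsSTPath D p → ¬ OnSeq tl hd b s p → ¬ OnSeq tl hd a s p
    avoids-b⇒avoids-a {b} hq obq Fa⊆Fb {p} h ¬obp oap =
      1≢0 (trans (sym (χ-on s p a (stPath-unique h) oap)) (proj₂ (Fb⊆Fa (χ s p) χ∈Fb)))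
      where
      Fb⊆Fa : NonnegFace D b ⊆ NonnegFace D a
      Fb⊆Fa = proj₂ (proj₂ facet) (NonnegFace D b) (nonnegFace-isFace b) (path⇒nonnegFace≢P hq obq) Fa⊆Fb
      χ∈Fb : NonnegFace D b (χ s p)
      χ∈Fb = stPath-flow h (stPath⇒s≢t hq obq) , χ-off s p b ¬obp

    no-exclusive-forcing-pair : ∀ b₁ b₂ → InÃ D b₁ → InÃ D b₂ →
                                (∀ {p} → IsSTPath D p → OnSeq tl hd b₁ s p → OnSeq tl hd a s p) →
                                (∀ {p} → IsSTPath D p → OnSeq tl hd b₂ s p → OnSeq tl hd a s p) →
                                (∀ {p} → IsSTPath D p → OnSeq tl hd b₁ s p → ¬ OnSeq tl hd b₂ s p) → ⊥
    no-exclusive-forcing-pair b₁ b₂ (p₁ , h₁ , o₁) (p₂ , h₂ , o₂) b₁⇒a b₂⇒a exclusive =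
      avoids-b⇒avoids-a h₁ o₁ Fa⊆Fb₁ h₂ (λ o → exclusive h₂ o o₂) (b₂⇒a h₂ o₂)
      where
      Fa⊆Fb₁ : NonnegFace D a ⊆ NonnegFace D b₁
      Fa⊆Fb₁ x (x∈P , xa≡0) = x∈P , zero-propagates x∈P a b₁ (λ p h → b₁⇒a h) xa≡0

    -- The face {x a = 0} is then empty, hence contained in every face {x b = 0}.
    unavoidable⇒single-path : (∀ {p} → IsSTPath D p → OnSeq tl hd a s p) →
                              ∀ {p q} → IsSTPath D p → IsSTPath D q → q ≡ p
    unavoidable⇒single-path a-on-all {p} {q} hp hq =
      onSeq⊆⇒≡ s q p (stPath-chain hq) (stPath-unique hq) (stPath-unique hp)
               (trans (stPath-end hq) (sym (stPath-end hp))) q⊆p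
      where
      Fa-empty : NonnegFace D a ⊆ (λ _ → ⊥)
      Fa-empty x (x∈P , xa≡0) = 1≢0 (trans (sym (coord-constant-on-paths x∈P a 1ℚ
                                  (λ p h → χ-on s p a (stPath-unique h) (a-on-all h)))) xa≡0)
      q⊆p : ∀ b → OnSeq tl hd b s q → OnSeq tl hd b s p
      q⊆p b obq with onSeq? b s p
      ... | yes obp = obp
      ... | no ¬obp = ⊥-elim (avoids-b⇒avoids-a hq obq (λ x → ⊥-elim ∘ Fa-empty x) hp ¬obp (a-on-all hp))

    module _ {u v vs} (corridor : IsCorridor D u (v ∷ vs)) (oa : OnSeq tl hd a u (v ∷ vs))
             {p₀ q} (h₀ : IsSTPath D p₀) (o₀ : OnSeq tl hd a s p₀) (hq : IsSTPath D q) (q≢p₀ : q ≢ p₀) where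

      open CorridorParts corridor

      private
        s≢t = stPath⇒s≢t h₀ o₀

        ¬single : ¬ (∀ {p} → IsSTPath D p → OnSeq tl hd a s p)
        ¬single a-on-all = q≢p₀ (unavoidable⇒single-path a-on-all h₀ hq)

      two-out-at-start : AtLeastTwo D (OutArcÃ D u)
      two-out-at-start with Count.two? (outArcÃ? u)
      ... | yes two = two
      ... | no ¬two = ⊥-elim (via-start (u ≟ s))
        where
        only-e₁ : ∀ b → OutArcÃ D u b → b ≡ e₁
        only-e₁ = ¬two⇒unique e₁ (arcs e₁ oe₁ , te₁≡u) ¬two
        out-of-u⇒a : ∀ {p b} → IsSTPath D p → OnSeq tl hd b s p → tl b ≡ u → OnSeq tl hd a s p
        out-of-u⇒a {p} {b} h ob tb≡u =
          corridor-arcs-together cor oe₁ oa h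
            (subst (λ b → OnSeq tl hd b s p) (only-e₁ b (stPath-Ã h b ob , tb≡u)) ob)
        via-start : Dec (u ≡ s) → ⊥
        via-start (yes u≡s) = ¬single a-on-all
          where
          a-on-all : ∀ {p} → IsSTPath D p → OnSeq tl hd a s p
          a-on-all {[]}    h = ⊥-elim (s≢t (stPath-end h))
          a-on-all {w ∷ p} h@((((f , tf≡s , hf≡w) , _) , _) , _) =
            out-of-u⇒a h (inj₁ (tf≡s , hf≡w)) (trans tf≡s (sym u≡s))
        via-start (no u≢s) with corridor-arcs-together cor oa oe₁ h₀ o₀
        ... | oe₁p₀ with pred-onSeq s p₀ e₁ (stPath-chain h₀) oe₁p₀ (λ te₁≡s → u≢s (trans (sym te₁≡u) te₁≡s))
        ...   | b₀ , ob₀ , hb₀≡te₁ with Count.¬exactlyOne⇒two (inArcÃ? u) b₀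
                                        (stPath-Ã h₀ b₀ ob₀ , trans hb₀≡te₁ te₁≡u) ¬one-in
          where
          ¬one-in : ¬ ExactlyOne D (InArcÃ D u)
          ¬one-in with notThrough-start
          ... | inj₁ ¬one = ¬one
          ... | inj₂ ¬one-out = ⊥-elim (¬one-out (e₁ , (arcs e₁ oe₁ , te₁≡u) , only-e₁))
        ...     | b₁ , b₂ , b₁≢b₂ , (ib₁ , hb₁≡u) , (ib₂ , hb₂≡u) =
          no-exclusive-forcing-pair b₁ b₂ ib₁ ib₂ (into-u⇒a hb₁≡u) (into-u⇒a hb₂≡u) exclusive
          where
          u≢t : u ≢ t
          u≢t u≡t = Ã⇒tl≢t e₁ (arcs e₁ oe₁) (trans te₁≡u u≡t)
          into-u⇒a : ∀ {b} → hd b ≡ u → ∀ {p} → IsSTPath D p → OnSeq tl hd b s p → OnSeq tl hd a s p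
          into-u⇒a {b} hb≡u {p} h ob
            with succ-onSeq s p b (stPath-chain h) ob
                   (λ hb≡end → u≢t (trans (sym hb≡u) (trans hb≡end (stPath-end h))))
          ... | b′ , ob′ , tb′≡hb = out-of-u⇒a h ob′ (trans tb′≡hb hb≡u)
          exclusive : ∀ {p} → IsSTPath D p → OnSeq tl hd b₁ s p → ¬ OnSeq tl hd b₂ s p
          exclusive {p} h o₁ o₂ =
            b₁≢b₂ (onSeq-hd-injective s p b₁ b₂ (stPath-unique h) o₁ o₂ (trans hb₁≡u (sym hb₂≡u)))

      two-in-at-end : AtLeastTwo D (InArcÃ D end)
      two-in-at-end with Count.two? (inArcÃ? end)
      ... | yes two = two
      ... | no ¬two = ⊥-elim (via-end (end ≟ t))
        where
        only-eₗ : ∀ b → InArcÃ D end b → b ≡ eₗ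
        only-eₗ = ¬two⇒unique eₗ (arcs eₗ oeₗ , heₗ≡end) ¬two
        into-end⇒a : ∀ {p b} → IsSTPath D p → OnSeq tl hd b s p → hd b ≡ end → OnSeq tl hd a s p
        into-end⇒a {p} {b} h ob hb≡end =
          corridor-arcs-together cor oeₗ oa h
            (subst (λ b → OnSeq tl hd b s p) (only-eₗ b (stPath-Ã h b ob , hb≡end)) ob)
        via-end : Dec (end ≡ t) → ⊥
        via-end (yes end≡t) = ¬single a-on-all
          where
          a-on-all : ∀ {p} → IsSTPath D p → OnSeq tl hd a s p
          a-on-all {[]}    h = ⊥-elim (s≢t (stPath-end h))
          a-on-all {w ∷ p} h with last-onSeq s w p (stPath-chain h)
          ... | b , ob , hb≡end′ = into-end⇒a h ob (trans hb≡end′ (trans (stPath-end h) (sym end≡t)))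
        via-end (no end≢t) with corridor-arcs-together cor oa oeₗ h₀ o₀
        ... | oeₗp₀ with succ-onSeq s p₀ eₗ (stPath-chain h₀) oeₗp₀
                           (λ heₗ≡end′ → end≢t (trans (sym heₗ≡end) (trans heₗ≡end′ (stPath-end h₀))))
        ...   | b₀ , ob₀ , tb₀≡heₗ with Count.¬exactlyOne⇒two (outArcÃ? end) b₀
                                        (stPath-Ã h₀ b₀ ob₀ , trans tb₀≡heₗ heₗ≡end) ¬one-out
          where
          ¬one-out : ¬ ExactlyOne D (OutArcÃ D end)
          ¬one-out with notThrough-end
          ... | inj₁ ¬one-in = ⊥-elim (¬one-in (eₗ , (arcs eₗ oeₗ , heₗ≡end) , only-eₗ))
          ... | inj₂ ¬one = ¬one
        ...     | b₁ , b₂ , b₁≢b₂ , (ib₁ , tb₁≡end) , (ib₂ , tb₂≡end) =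
          no-exclusive-forcing-pair b₁ b₂ ib₁ ib₂ (out-of-end⇒a tb₁≡end) (out-of-end⇒a tb₂≡end) exclusive
          where
          end≢s : end ≢ s
          end≢s end≡s = Ã⇒hd≢s eₗ (arcs eₗ oeₗ) (trans heₗ≡end end≡s)
          out-of-end⇒a : ∀ {b} → tl b ≡ end → ∀ {p} → IsSTPath D p → OnSeq tl hd b s p → OnSeq tl hd a s p
          out-of-end⇒a {b} tb≡end {p} h ob
            with pred-onSeq s p b (stPath-chain h) ob (λ tb≡s → end≢s (trans (sym tb≡end) tb≡s))
          ... | b′ , ob′ , hb′≡tb = into-end⇒a h ob′ (trans hb′≡tb tb≡end)
          exclusive : ∀ {p} → IsSTPath D p → OnSeq tl hd b₁ s p → ¬ OnSeq tl hd b₂ s p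
          exclusive {p} h o₁ o₂ =
            b₁≢b₂ (onSeq-tl-injective s p b₁ b₂ (stPath-unique h) o₁ o₂ (trans tb₁≡end (sym tb₂≡end)))

    facet⇒condition : InÃ D a × (SingleSTPath D ⊎ GoodArc D a)
    facet⇒condition with InÃ? a
    ... | no a∉Ã = ⊥-elim (proj₁ (proj₂ facet) λ x → mk⇔ proj₁ λ x∈P → x∈P ,
                             coord-constant-on-paths x∈P a 0ℚ (λ p h → χ-off s p a (λ o → a∉Ã (p , h , o))))
    ... | yes a∈Ã@(p₀ , h₀ , o₀) = a∈Ã , other-path (stPath-∃? (_≢ p₀) (λ q → ¬? (List.≡-dec _≟_ q p₀)))
      where
      other-path : Dec (∃[ q ] (IsSTPath D q × q ≢ p₀)) → SingleSTPath D ⊎ GoodArc D a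
      other-path (no ∄q) = inj₁ (p₀ , h₀ , only-p₀)
        where
        only-p₀ : ∀ q → IsSTPath D q → q ≡ p₀
        only-p₀ q hq with List.≡-dec _≟_ q p₀
        ... | yes q≡p₀ = q≡p₀
        ... | no q≢p₀  = ⊥-elim (∄q (q , hq , q≢p₀))
      other-path (yes (q , hq , q≢p₀)) with Ã⇒on-corridor a∈Ã
      ... | u , [] , _ , ()
      ... | u , v ∷ vs , corridor , oa =
        inj₂ (u , v ∷ vs , (corridor , two-out-at-start corridor oa h₀ o₀ hq q≢p₀
                                     , two-in-at-end corridor oa h₀ o₀ hq q≢p₀) , oa)

  another : ∀ {P : Fin m → Set} → AtLeastTwo D P → ∀ e → ∃[ b ] (P b × b ≢ e)
  another (b₁ , b₂ , b₁≢b₂ , pb₁ , pb₂) e with b₁ ≟ e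
  ... | yes refl = b₂ , pb₂ , b₁≢b₂ ∘ sym
  ... | no b₁≢e  = b₁ , pb₁ , b₁≢e

  stPath-suffix : ∀ {p b} → IsSTPath D p → OnSeq tl hd b s p →
                  ∃[ r ] (Chain tl hd (tl b) (hd b ∷ r) × ArcsInÃ (tl b) (hd b ∷ r) × endOf (hd b) r ≡ t)
  stPath-suffix {p} {b} h ob with onSeq-split b s p ob
  ... | q , r , refl , end-q≡tb =
    r , subst (λ y → Chain tl hd y (hd b ∷ r)) end-q≡tb (chain-++ʳ s q (hd b ∷ r) (stPath-chain h)) ,
    (λ b′ o → stPath-Ã h b′ (onSeq-++⁺ʳ b′ s q (hd b ∷ r)
                              (subst (λ y → OnSeq tl hd b′ y (hd b ∷ r)) (sym end-q≡tb) o))) ,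
    trans (sym (endOf-++ s q (hd b ∷ r))) (stPath-end h)

  stPath-prefix : ∀ {p b} → IsSTPath D p → OnSeq tl hd b s p →
                  ∃[ q ] (Chain tl hd s q × ArcsInÃ s q × endOf s q ≡ hd b × OnSeq tl hd b s q)
  stPath-prefix {p} {b} h ob with onSeq-split b s p ob
  ... | q , r , refl , end-q≡tb =
    q ++ [ hd b ] , chain-++ˡ s (q ++ [ hd b ]) r chain ,
    (λ b′ o → stPath-Ã h b′ (subst (OnSeq tl hd b′ s) (sym p≡) (onSeq-++⁺ˡ b′ s (q ++ [ hd b ]) r o))) ,
    endOf-∷ʳ s q (hd b) ,
    onSeq-++⁺ʳ b s q [ hd b ] (inj₁ (sym end-q≡tb , refl))
    where
    p≡ : q ++ hd b ∷ r ≡ (q ++ [ hd b ]) ++ r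
    p≡ = sym (List.++-assoc q [ hd b ] r)
    chain : Chain tl hd s ((q ++ [ hd b ]) ++ r)
    chain = subst (Chain tl hd s) p≡ (stPath-chain h)

  cost : (Fin m → ℚ) → Fin n → List (Fin n) → ℚ
  cost c z xs = dot c (χ z xs)

  cost-++ : ∀ c z xs ys → cost c z (xs ++ ys) ≡ cost c z xs + cost c (endOf z xs) ys
  cost-++ c z xs ys = trans (dot-cong c (χ-++ z xs ys)) (dot-+ c (χ z xs) (χ (endOf z xs) ys))

  -- An s–t path through a splits as (s → start) ++ corridor ++ (end → t). Gluing either outer part
  -- to the bypass leaving the start (resp. entering the end) along an arc off the corridor gives an
  -- s–t path avoiding a, of cost δ; so the costs of both outer parts do not depend on the path.
  module Exchange (c : Fin m → ℚ) (δ : ℚ) {a : Fin m}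
                  (avoiding : ∀ {p} → IsSTPath D p → ¬ OnSeq tl hd a s p → cost c s p ≡ δ)
                  {u v vs} (good : IsGoodCorridor D u (v ∷ vs)) (oa : OnSeq tl hd a u (v ∷ vs)) where

    open CorridorParts (proj₁ good)

    private
      W = v ∷ vs

      u∉W : ¬ u ∈ W
      u∉W with chain-unique u W chain
      ... | u∉ ∷ _ = All¬⇒¬Any u∉

      start-bypass : ∃[ R ] (Chain tl hd u R × endOf u R ≡ t × ¬ OnSeq tl hd a u R)
      start-bypass with another (proj₁ (proj₂ good)) e₁
      ... | o , ((po , ho , oo) , to≡u) , o≢e₁ with stPath-suffix ho oo
      ...   | r , c-r , ar-r , end-r =
        hd o ∷ r , subst (λ y → Chain tl hd y (hd o ∷ r)) to≡u c-r , end-r ,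
        λ oaR → a∉ (subst (λ y → OnSeq tl hd a y (hd o ∷ r)) (sym to≡u) oaR)
        where
        a∉ : ¬ OnSeq tl hd a (tl o) (hd o ∷ r)
        a∉ oaR with enters-corridor cor oa c-r ar-r oaR
        ... | inj₂ tlo∈W = u∉W (subst (_∈ W) to≡u tlo∈W)
        ... | inj₁ (b , tb≡u , hb≡v , ob) =
          let b≡o = onSeq-tl-injective (tl o) (hd o ∷ r) b o (chain-unique _ _ c-r) ob (inj₁ (refl , refl))
                                        (trans tb≡u (sym to≡u))
          in o≢e₁ (simple o e₁ (trans to≡u (sym te₁≡u)) (trans (cong hd (sym b≡o)) (trans hb≡v (sym he₁≡v))))

      end-bypass : ∃[ L ] (Chain tl hd s L × endOf s L ≡ end × ¬ OnSeq tl hd a s L)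
      end-bypass with another (proj₂ (proj₂ good)) eₗ
      ... | i , ((pi , hi , oi) , hi≡end) , i≢eₗ with stPath-prefix hi oi
      ...   | L , c-L , ar-L , end-L , oiL = L , c-L , trans end-L hi≡end , a∉
        where
        walk-L : ÃWalk s L
        walk-L = c-L , ar-L , subst (NotThrough D) (sym (trans end-L hi≡end)) notThrough-end
        a∉ : ¬ OnSeq tl hd a s L
        a∉ oaL with traverses-corridor cor oa walk-L (s∉Ã-chain u W chain arcs) oaL
        ... | q , r , refl , end-q≡u =
          i≢eₗ (sym (onSeq-hd-injective s (q ++ W ++ r) eₗ i (chain-unique s _ c-L)
                      (corridor-onSeq s q W r end-q≡u oeₗ) oiL (trans heₗ≡end (sym hi≡end))))

    avoiding-concat : ∀ w q r → Chain tl hd s q → endOf s q ≡ w → Chain tl hd w r → endOf w r ≡ t →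
                      ¬ OnSeq tl hd a s q → ¬ OnSeq tl hd a w r → cost c s q + cost c w r ≡ δ
    avoiding-concat w q r c-q end-q c-r end-r a∉q a∉r =
      trans (sym (trans (cost-++ c s q r) (cong (λ y → cost c s q + cost c y r) end-q))) (avoiding path a∉path)
      where
      path : IsSTPath D (q ++ r)
      path = chain⇒stPath (q ++ r) (chain-++ s q r c-q (subst (λ y → Chain tl hd y r) (sym end-q) c-r))
                          (trans (endOf-++ s q r) (trans (cong (λ y → endOf y r) end-q) end-r))
      a∉path : ¬ OnSeq tl hd a s (q ++ r)
      a∉path o with onSeq-++⁻ a s q r o
      ... | inj₁ oq = a∉q oq
      ... | inj₂ or = a∉r (subst (λ y → OnSeq tl hd a y r) end-q or)

    record Traversal (p : List (Fin n)) : Set where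
      field
        before after : List (Fin n)
        chain-before : Chain tl hd s before
        end-before   : endOf s before ≡ u
        chain-after  : Chain tl hd end after
        end-after    : endOf end after ≡ t
        a∉before     : ¬ OnSeq tl hd a s before
        a∉after      : ¬ OnSeq tl hd a end after
        cost-split   : cost c s p ≡ cost c s before + (cost c u W + cost c end after)

    traversal : ∀ {p} → IsSTPath D p → OnSeq tl hd a s p → Traversal p
    traversal {p} h oap with stPath-traverses cor oa h oap
    ... | q , r , refl , end-q≡u = record
      { before = q ; after = r
      ; chain-before = chain-++ˡ s q (W ++ r) (stPath-chain h)
      ; end-before   = end-q≡u
      ; chain-after  = chain-++ʳ (endOf s q) W r (chain-++ʳ s q (W ++ r) (stPath-chain h))
      ; end-after    = trans (sym (trans (endOf-++ s q (W ++ r)) (endOf-++ (endOf s q) W r))) (stPath-end h)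
      ; a∉before     = λ oq → disjoint-++ q (W ++ r) unique (onSeq⇒hd∈ a s q oq) (∈-++⁺ˡ (onSeq⇒hd∈ a u W oa))
      ; a∉after      = λ or → disjoint-++ W r (unique-++ʳ q (W ++ r) unique)
                                  (onSeq⇒hd∈ a u W oa) (onSeq⇒hd∈ a end r or)
      ; cost-split   = trans (cost-++ c s q (W ++ r))
                         (cong₂ (λ y z → cost c s q + z) end-q≡u
                           (trans (cong (λ y → cost c y (W ++ r)) end-q≡u) (cost-++ c u W r)))
      }
      where
      unique : Unique (q ++ W ++ r)
      unique with stPath-unique h
      ... | _ ∷ u′ = u′

    through-a-equal-cost : ∀ {p p′} → IsSTPath D p → IsSTPath D p′ → OnSeq tl hd a s p → OnSeq tl hd a s p′ →
                           cost c s p ≡ cost c s p′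
    through-a-equal-cost {p} {p′} h h′ o o′ = begin
      cost c s p                                          ≡⟨ cost-split T ⟩
      cost c s (before T) + (cost c u W + cost c end (after T))
        ≡⟨ cong₂ (λ y z → y + (cost c u W + z)) same-before same-after ⟩
      cost c s (before T′) + (cost c u W + cost c end (after T′)) ≡⟨ sym (cost-split T′) ⟩
      cost c s p′                                         ∎
      where
      open ≡-Reasoning
      open Traversal
      T = traversal h o
      T′ = traversal h′ o′
      same-before : cost c s (before T) ≡ cost c s (before T′)
      same-before with start-bypass
      ... | R , c-R , end-R , a∉R =
        ∙-cancelʳ (cost c u R) _ _
          (trans (avoiding-concat u _ R (chain-before T) (end-before T) c-R end-R (a∉before T) a∉R)
            (sym (avoiding-concat u _ R (chain-before T′) (end-before T′) c-R end-R (a∉before T′) a∉R)))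
      same-after : cost c end (after T) ≡ cost c end (after T′)
      same-after with end-bypass
      ... | L , c-L , end-L , a∉L =
        ∙-cancelˡ (cost c s L) _ _
          (trans (avoiding-concat end L _ c-L end-L (chain-after T) (end-after T) a∉L (a∉after T))
            (sym (avoiding-concat end L _ c-L end-L (chain-after T′) (end-after T′) a∉L (a∉after T′))))

  condition⇒facet : ∀ {a} → InÃ D a → SingleSTPath D ⊎ GoodArc D a →
                    IsFacet (FlowPolytope D) (NonnegFace D a)
  condition⇒facet {a} (p₀ , h₀ , o₀) condition = nonnegFace-isFace a , path⇒nonnegFace≢P h₀ o₀ , maximal
    where
    s≢t = stPath⇒s≢t h₀ o₀

    module _ (c : Fin m → ℚ) (δ : ℚ) (Fa⊆G : NonnegFace D a ⊆ λ x → FlowPolytope D x × dot c x ≡ δ) where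

      avoiding : ∀ {p} → IsSTPath D p → ¬ OnSeq tl hd a s p → cost c s p ≡ δ
      avoiding {p} h ¬o = proj₂ (Fa⊆G (χ s p) (stPath-flow h s≢t , χ-off s p a ¬o))

      through-a : SingleSTPath D ⊎ GoodArc D a →
                  ∀ {p₁} → IsSTPath D p₁ → OnSeq tl hd a s p₁ → cost c s p₁ ≡ δ →
                  ∀ {p} → IsSTPath D p → OnSeq tl hd a s p → cost c s p ≡ δ
      through-a (inj₁ (_ , _ , single)) {p₁} h₁ _ cost₁≡δ {p} h _ =
        subst (λ p → cost c s p ≡ δ) (trans (single p₁ h₁) (sym (single p h))) cost₁≡δ
      through-a (inj₂ (u , [] , _ , ()))
      through-a (inj₂ (u , v ∷ vs , good , oa)) h₁ o₁ cost₁≡δ h o =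
        trans (Exchange.through-a-equal-cost c δ {a} avoiding {u} {v} {vs} good oa h h₁ o o₁) cost₁≡δ

      all-paths : ∀ {y} → FlowPolytope D y → (∀ x → FlowPolytope D x → dot c x ≤ δ) → dot c y ≡ δ →
                  0ℚ < y a → ∀ p → IsSTPath D p → cost c s p ≡ δ
      all-paths y∈P valid cy≡δ 0<ya p h with onSeq? a s p
      ... | no ¬o = avoiding h ¬o
      ... | yes o =
        let p₁ , h₁ , o₁ , cost₁≡δ = tight-path y∈P c δ valid cy≡δ a 0<ya
        in through-a condition h₁ o₁ cost₁≡δ h o

    maximal : ∀ G → IsFace (FlowPolytope D) G → ¬ (G ≐ FlowPolytope D) →
              NonnegFace D a ⊆ G → G ⊆ NonnegFace D a
    maximal G (inj₁ G≐P) G≢P _ = ⊥-elim (G≢P G≐P)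
    maximal G (inj₂ (c , δ , _ , valid , G≐)) G≢P Fa⊆G y y∈G = on-face (Equivalence.to (G≐ y) y∈G)
      where
      on-face : FlowPolytope D y × dot c y ≡ δ → NonnegFace D a y
      on-face (y∈P , cy≡δ) with 0≤-cases (proj₁ y∈P a)
      ... | inj₁ ya≡0 = y∈P , ya≡0
      ... | inj₂ 0<ya = ⊥-elim (G≢P λ x → mk⇔ (proj₁ ∘ Equivalence.to (G≐ x)) λ x∈P →
             Equivalence.from (G≐ x) (x∈P , constant-on-paths x∈P c δ
               (all-paths c δ (λ x → Equivalence.to (G≐ x) ∘ Fa⊆G x) y∈P valid cy≡δ 0<ya)))

proposition3 : (D : Network) (a : Fin (Network.m D)) →
    IsFacet (FlowPolytope D) (NonnegFace D a) ⇔ (InÃ D a × (SingleSTPath D ⊎ GoodArc D a))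
proposition3 D a = mk⇔ (FacetFacts.facet⇒condition D) λ (a∈Ã , condition) → condition⇒facet D a∈Ã condition
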